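{- Let $n\ge1$ and let $p$ be a prime not dividing $n$. Then either every dessin in $GP(n,p)$ is isomorphic to its mirror image (is real), or every dessin in $GP(n,p)$ is non-isomorphic to its mirror image (they form chiral pairs); the first case occurs if and only if $-1$ is congruent to a power of $p$ modulo $n$.
   Context: A regular dessin is determined up to isomorphism by a triple $(G;x,y)$ with $G$ a finite group generated by $x,y$; $(G;x,y)$ and $(G';x',y')$ give isomorphic dessins iff some isomorphism $G\to G'$ sends $x\mapsto x'$, $y\mapsto y'$. The mirror image of the dessin $(G;x,y)$ is the dessin $(G;x^{ -1},y^{ -1})$; a dessin is real if it is isomorphic to its mirror image. Generalised Paley dessins: let $p$ be prime, $d\ge1$, $q=p^d$. Let ${\rm AGL}_1(q)$ be the group of maps $t\mapsto at+b$ of ${\mathbb F}_q$ ($a\ne0$), $T=\{t\mapsto t+b\}$. For a subgroup $S\le{\mathbb F}_q^*$ of order $n$ (identified with $\{t\mapsto at:a\in S\}$), $G_S=T\rtimes S$, where either $n=d=1$, or $n>1$ and $p$ has multiplicative order $d$ mod $n$. For $x$ a generator of $S$ and $y\in G_S\setminus S$, the regular dessin $(G_S;x,y)$ is a generalised Paley dessin with valency $n$ and field characteristic $p$. $GP(n,p)$ denotes the set of isomorphism classes of such dessins. -}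

module Defs where

open import Data.Nat using (ℕ; zero; suc; _∸_; _^_; _≤_; _<_)
open import Data.Nat.Divisibility using (_∣_)
open import Data.Fin using (Fin)
open import Data.Product using (Σ; ∃; _×_; _,_; proj₁; proj₂)
open import Relation.Binary.PropositionalEquality using (_≡_)
open import Relation.Nullary using (¬_)
open import Algebra.Core using (Op₁; Op₂)
open import Algebra.Structures using (IsCommutativeRing)

-- d is the multiplicative order of p modulo n:
-- d ≥ 1, p^d ≡ 1 (mod n), and no smaller positive exponent works.
-- (For n = 1 this gives d = 1, matching the convention n = d = 1.)

IsMultOrder : ℕ → ℕ → ℕ → Set
IsMultOrder p n d =
  1 ≤ d × n ∣ (p ^ d ∸ 1) × (∀ e → 1 ≤ e → e < d → ¬ (n ∣ (p ^ e ∸ 1)))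

-- A field with exactly q elements: a field structure on Fin q
-- (every finite field is isomorphic to one of this form, and all
-- fields of order q are isomorphic, so this is "the" field F_q).

record FiniteField (q : ℕ) : Set where
  field
    _+_ _*_ : Op₂ (Fin q)
    -_      : Op₁ (Fin q)
    0# 1#   : Fin q
    isCommutativeRing : IsCommutativeRing _≡_ _+_ _*_ -_ 0# 1#
    0≢1     : ¬ (0# ≡ 1#)
    inverse : ∀ a → ¬ (a ≡ 0#) → ∃ λ b → a * b ≡ 1#

  infixl 7 _*_
  infixl 6 _+_

  pow : Fin q → ℕ → Fin q
  pow a zero    = 1#
  pow a (suc k) = a * pow a k

module AffineGroup {q : ℕ} (K : FiniteField q) where
  open FiniteField K

  HasOrder : Fin q → ℕ → Set
  HasOrder x n = 1 ≤ n × pow x n ≡ 1# × (∀ k → 1 ≤ k → k < n → ¬ (pow x k ≡ 1#))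

  -- an affine map t ↦ a t + b of F_q, encoded as the pair (a , b)
  Aff : Set
  Aff = Fin q × Fin q

  _∘ₐ_ : Aff → Aff → Aff
  (a , b) ∘ₐ (c , e) = (a * c , a * e + b)

  idₐ : Aff
  idₐ = (1# , 0#)

  InS : Fin q → Fin q → Set
  InS x a = ∃ λ k → a ≡ pow x k

  InSₐ : Fin q → Aff → Set
  InSₐ x (a , b) = InS x a × b ≡ 0#

  InG : Fin q → Aff → Set
  InG x (a , b) = InS x a

  -- (x , y) defines a generalised Paley dessin (G_S ; x , y) of valency n,
  -- where S = ⟨x⟩ has order n: x is a generator of S, y ∈ G_S ∖ S.
  IsGP : ℕ → Fin q → Aff → Set
  IsGP n x y = HasOrder x n × InG x y × ¬ InSₐ x y

  IsInv : Aff → Aff → Set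
  IsInv g g' = (g ∘ₐ g' ≡ idₐ) × (g' ∘ₐ g ≡ idₐ)

  -- the dessin (G_S ; x , y) is isomorphic to its mirror (G_S ; x⁻¹ , y⁻¹):
  -- there is an automorphism φ of G_S with φ x = x⁻¹ and φ y = y⁻¹.
  Real : Fin q → Aff → Set
  Real x y = Σ (Aff → Aff) λ φ →
      (∀ g → InG x g → InG x (φ g))
    × (∀ g h → InG x g → InG x h → φ (g ∘ₐ h) ≡ φ g ∘ₐ φ h)
    × (∀ g h → InG x g → InG x h → φ g ≡ φ h → g ≡ h)
    × (∀ h → InG x h → ∃ λ g → InG x g × φ g ≡ h)
    × IsInv (x , 0#) (φ (x , 0#))
    × IsInv y (φ y)

  AllReal : ℕ → Set
  AllReal n = ∀ x y → IsGP n x y → Real x y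

  AllChiral : ℕ → Set
  AllChiral n = ∀ x y → IsGP n x y → ¬ Real x y

{-# OPTIONS --safe #-}

-- Write S = ⟨x⟩ ≤ 𝔽_q^* (of order n) and σ_k t = t^(p^k).  If n ∣ p^k + 1 then σ_k inverts every
-- element of S, and (a , b) ↦ (σ_k a , γ σ_k b) is an automorphism of G_S sending x to x⁻¹; a
-- suitable γ makes it send y to y⁻¹ as well, so every dessin in GP(n,p) is real.  Conversely, a
-- mirror automorphism φ fixes the linear part of every translation (dilation by x ≠ 1 commutes with
-- translations up to conjugation), so its translation part f is additive, injective and satisfies
-- f(x b) = x⁻¹ f(b), hence f(P(x) b) = P(x⁻¹) f(b) for every P over 𝔽_p.  A nonzero P of degree
-- ≤ d over 𝔽_p vanishes at x; its roots include the d distinct conjugates x^(p^i), so the root x⁻¹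
-- is one of them and n ∣ p^i + 1.  The criterion does not mention the dessin, whence the dichotomy;
-- a dessin exists at all because 𝔽_q^* is cyclic of order q − 1, a multiple of n.
module Submission where

open import Defs
open import Data.Nat using (ℕ; zero; suc; _≤_; _<_; z≤n; s≤s)
import Data.Nat as ℕ
import Data.Nat.Properties as ℕ
open import Data.Nat.Divisibility using (_∣_; _∣?_; divides; 1∣_; ∣⇒≤; m%n≡0⇒n∣m)
open import Data.Nat.DivMod using (_%_; _/_; m≡m%n+[m/n]*n; m%n<n)
open import Data.Nat.Primality using (Prime; prime⇒nonZero)
open import Data.Nat.Coprimality using (Coprime; coprime-divisor; coprime-Bézout; prime⇒coprime)
import Data.Nat.Coprimality as Coprime
open import Data.Nat.GCD using (module Bézout)
open import Data.Nat.Combinatorics using (_C_; nCk≡nC[n∸k]; nCn≡1)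
open import Data.Nat.Induction using (<-wellFounded)
open import Data.Fin using (Fin; toℕ) renaming (zero to fzero; suc to fsuc)
import Data.Fin as Fin
import Data.Fin.Properties as Fin
open import Data.Fin.Permutation using (Permutation′; permutation)
open import Data.List using (List; []; _∷_; _++_; length; replicate; zipWith)
open import Data.List.Properties using (∷-injective; length-zipWith)
open import Data.List.Relation.Unary.All using (All; []; _∷_)
open import Data.List.Relation.Unary.Any using (Any; here; there)
open import Data.Maybe using (nothing)
open import Data.Product using (∃; ∃₂; _×_; _,_; proj₁; proj₂)
open import Data.Sum using (_⊎_; inj₁; inj₂)
open import Data.Empty using (⊥-elim)
open import Function using (_∘_; id)
open import Induction.WellFounded using (Acc; acc)
open import Relation.Nullary using (¬_; Dec; yes; no; ¬?; _→-dec_)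
open import Relation.Nullary.Decidable using (_×-dec_)
open import Relation.Unary using (Pred; Decidable)
open import Relation.Binary.Definitions using (tri<; tri≈; tri>)
open import Relation.Binary.PropositionalEquality
open import Algebra.Bundles using (CommutativeRing)
open import Algebra.Structures using (IsCommutativeRing)
open import Tactic.RingSolver using (solve-∀)
open import Tactic.RingSolver.Core.AlmostCommutativeRing using (AlmostCommutativeRing; fromCommutativeRing)

module _ where
  open import Data.Nat using (_+_; _*_; _∸_; _^_; _!; _<?_; _≤?_; nonTrivial⇒n>1; >-nonZero)
  open import Data.Nat.Properties
  open import Data.Nat.Divisibility
  open import Data.Nat.Primality
  open import Data.Nat.Combinatorics using (k![n∸k]!∣n!)
  open import Data.Nat.Combinatorics.Specification using (nCk≡n!/k![n-k]!)
  open import Data.Nat.DivMod using (m/n*n≡m)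
  open import Data.Nat.ListAction using (product)
  open import Data.Nat.Primality.Factorisation using (factorise)

  prime⇒>1 : ∀ {p} → Prime p → 1 < p
  prime⇒>1 {p} pr = nonTrivial⇒n>1 p {{prime⇒nonTrivial pr}}

  prime∤! : ∀ {p} → Prime p → ∀ m → m < p → ¬ p ∣ m !
  prime∤! pr zero    _   p∣1  = <⇒≢ (prime⇒>1 pr) (sym (∣1⇒≡1 p∣1))
  prime∤! pr (suc m) m<p p∣m! with euclidsLemma (suc m) (m !) pr p∣m!
  ... | inj₁ p∣1+m = <⇒≱ m<p (∣⇒≤ p∣1+m)
  ... | inj₂ p∣m!′ = prime∤! pr m (<-trans (n<1+n m) m<p) p∣m!′

  prime∣choose : ∀ {p k} → Prime p → 0 < k → k < p → p ∣ p C k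
  prime∣choose {p@(suc p-1)} {k} pr 0<k k<p
    with euclidsLemma (p C k) (k ! * (p ∸ k) !) pr p∣pCk*k!*[p∸k]!
    where
    instance _ = k !* (p ∸ k) !≢0
    p∣pCk*k!*[p∸k]! : p ∣ (p C k) * (k ! * (p ∸ k) !)
    p∣pCk*k!*[p∸k]! = subst (p ∣_)
      (sym (trans (cong (_* (k ! * (p ∸ k) !)) (nCk≡n!/k![n-k]! (<⇒≤ k<p)))
                  (m/n*n≡m (k![n∸k]!∣n! (<⇒≤ k<p)))))
      (m∣m*n (p-1 !))
  ... | inj₁ p∣pCk = p∣pCk
  ... | inj₂ p∣k!*[p∸k]! with euclidsLemma (k !) ((p ∸ k) !) pr p∣k!*[p∸k]!
  ...   | inj₁ p∣k!     = ⊥-elim (prime∤! pr k k<p p∣k!)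
  ...   | inj₂ p∣[p∸k]! = ⊥-elim (prime∤! pr (p ∸ k) (∸-monoʳ-< 0<k (<⇒≤ k<p)) p∣[p∸k]!)

  coprime-* : ∀ {a b m} → Coprime a m → Coprime b m → Coprime (a * b) m
  coprime-* {a} a⊥m b⊥m {d} (d∣ab , d∣m) = b⊥m (coprime-divisor d⊥a d∣ab , d∣m)
    where
    d⊥a : Coprime d a
    d⊥a (e∣d , e∣a) = a⊥m (e∣a , ∣-trans e∣d d∣m)

  coprime-^ : ∀ {a m} → Coprime a m → ∀ k → Coprime (a ^ k) m
  coprime-^ a⊥m zero    (d∣1 , _) = ∣1⇒≡1 d∣1
  coprime-^ a⊥m (suc k) = coprime-* a⊥m (coprime-^ a⊥m k)

  prime∤⇒coprime : ∀ {ℓ m} → Prime ℓ → ¬ ℓ ∣ m → Coprime ℓ m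
  prime∤⇒coprime pr ℓ∤m (d∣ℓ , d∣m) with prime⇒irreducible pr d∣ℓ
  ... | inj₁ d≡1 = d≡1
  ... | inj₂ refl = ⊥-elim (ℓ∤m d∣m)

  coprime⇒*∣ : ∀ {a b o} → Coprime a b → a ∣ o → b ∣ o → a * b ∣ o
  coprime⇒*∣ {a} {b} a⊥b (divides c o≡ca) b∣o
    with coprime-divisor (Coprime.sym a⊥b) (subst (b ∣_) (trans o≡ca (*-comm c a)) b∣o)
  ... | divides c′ c≡c′b = divides c′ (begin
    _             ≡⟨ o≡ca ⟩
    c * a         ≡⟨ cong (_* a) c≡c′b ⟩
    c′ * b * a    ≡⟨ *-assoc c′ b a ⟩
    c′ * (b * a)  ≡⟨ cong (c′ *_) (*-comm b a) ⟩
    c′ * (a * b)  ∎)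
    where open ≡-Reasoning

  prime-divisor : ∀ r → 1 < r → ∃ λ ℓ → Prime ℓ × ℓ ∣ r
  prime-divisor r@(suc _) 1<r with factorise r
  ... | record { factors = [] ; isFactorisation = r≡1 } = ⊥-elim (<⇒≢ 1<r (sym r≡1))
  ... | record { factors = ℓ ∷ ℓs ; isFactorisation = r≡ℓ*Πℓs ; factorsPrime = pr ∷ _ } =
    ℓ , pr , subst (ℓ ∣_) (sym r≡ℓ*Πℓs) (m∣m*n (product ℓs))

  record Valuation (ℓ x : ℕ) : Set where
    constructor mkValuation
    field
      exponent cofactor : ℕ
      x≡ℓ^e*m : x ≡ ℓ ^ exponent * cofactor
      ℓ∤m : ¬ ℓ ∣ cofactor

  valuation : ∀ {ℓ} → Prime ℓ → ∀ x → 0 < x → Valuation ℓ x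
  valuation {ℓ} pr x = go x (<-wellFounded x)
    where
    go : ∀ x → Acc _<_ x → 0 < x → Valuation ℓ x
    go x (acc rs) 0<x with ℓ ∣? x
    ... | no ℓ∤x = mkValuation 0 x (sym (+-identityʳ x)) ℓ∤x
    ... | yes (divides c x≡cℓ) with go c (rs c<x) 0<c
      where
      0<c : 0 < c
      0<c = n≢0⇒n>0 λ { refl → <⇒≢ 0<x (sym x≡cℓ) }
      c<x : c < x
      c<x = subst (c <_) (sym x≡cℓ) (m<m*n c ℓ {{>-nonZero 0<c}} (prime⇒>1 pr))
    ... | mkValuation a m c≡ℓ^a*m ℓ∤m = mkValuation (suc a) m x≡ℓ^[1+a]*m ℓ∤m
      where
      open ≡-Reasoning
      x≡ℓ^[1+a]*m : x ≡ ℓ * ℓ ^ a * m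
      x≡ℓ^[1+a]*m = begin
        x               ≡⟨ x≡cℓ ⟩
        c * ℓ           ≡⟨ *-comm c ℓ ⟩
        ℓ * c           ≡⟨ cong (ℓ *_) c≡ℓ^a*m ⟩
        ℓ * (ℓ ^ a * m) ≡⟨ *-assoc ℓ (ℓ ^ a) m ⟨
        ℓ * ℓ ^ a * m   ∎

  ^-monoʳ-∣ : ∀ m {n o} → n ≤ o → m ^ n ∣ m ^ o
  ^-monoʳ-∣ m {n} {o} n≤o = divides (m ^ (o ∸ n)) (begin
    m ^ o                ≡⟨ cong (m ^_) (m+[n∸m]≡n n≤o) ⟨
    m ^ (n + (o ∸ n))    ≡⟨ ^-distribˡ-+-* m n (o ∸ n) ⟩
    m ^ n * m ^ (o ∸ n)  ≡⟨ *-comm (m ^ n) _ ⟩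
    m ^ (o ∸ n) * m ^ n  ∎)
    where open ≡-Reasoning

  record ExcessPrimePower (r e : ℕ) : Set where
    constructor mkExcess
    field
      {ℓ a}   : ℕ
      ℓ-prime : Prime ℓ
      ℓ^a∣r   : ℓ ^ a ∣ r
      ν       : Valuation ℓ e
      ν<a     : Valuation.exponent ν < a

  ∤⇒excessPrimePower : ∀ r e → 0 < r → 0 < e → ¬ r ∣ e → ExcessPrimePower r e
  ∤⇒excessPrimePower r e 0<r 0<e = go r (<-wellFounded r) 0<r
    where
    go : ∀ r → Acc _<_ r → 0 < r → ¬ r ∣ e → ExcessPrimePower r e
    go 1 _ _ 1∤e = ⊥-elim (1∤e (1∣ e))
    go r@(suc (suc _)) (acc rs) 0<r r∤e
      with prime-divisor r (s≤s (s≤s z≤n))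
    ... | ℓ , pr , ℓ∣r
      with valuation pr r 0<r | valuation pr e 0<e
    ... | mkValuation a m r≡ℓ^a*m ℓ∤m | νₑ@(mkValuation b m′ e≡ℓ^b*m′ _)
      with b <? a
    ... | yes b<a = mkExcess pr (divides m (trans r≡ℓ^a*m (*-comm _ m))) νₑ b<a
    ... | no b≮a = lift (go m (rs m<r) 0<m m∤e)
      where
      ℓ^a∣e : ℓ ^ a ∣ e
      ℓ^a∣e = ∣-trans (^-monoʳ-∣ ℓ (≮⇒≥ b≮a)) (divides m′ (trans e≡ℓ^b*m′ (*-comm (ℓ ^ b) m′)))
      m∤e : ¬ m ∣ e
      m∤e m∣e = r∤e (subst (_∣ e) (sym r≡ℓ^a*m)
        (coprime⇒*∣ (coprime-^ (prime∤⇒coprime pr ℓ∤m) a) ℓ^a∣e m∣e))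
      0<m : 0 < m
      0<m = n≢0⇒n>0 λ { refl → <⇒≢ 0<r (sym (trans r≡ℓ^a*m (*-zeroʳ (ℓ ^ a)))) }
      0<a : 0 < a
      0<a = n≢0⇒n>0 λ { refl → ℓ∤m (subst (ℓ ∣_) (trans r≡ℓ^a*m (+-identityʳ m)) ℓ∣r) }
      1<ℓ^a : 1 < ℓ ^ a
      1<ℓ^a = ^-monoʳ-< ℓ (prime⇒>1 pr) 0<a
      m<r : m < r
      m<r = subst (m <_) (trans (*-comm m _) (sym r≡ℓ^a*m)) (m<m*n m (ℓ ^ a) {{>-nonZero 0<m}} 1<ℓ^a)
      lift : ExcessPrimePower m e → ExcessPrimePower r e
      lift (mkExcess pr′ ℓ′^a′∣m ν′ ν′<a′) =
        mkExcess pr′ (∣-trans ℓ′^a′∣m (divides (ℓ ^ a) r≡ℓ^a*m)) ν′ ν′<a′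

  least-positive : ∀ {ℓ} {P : Pred ℕ ℓ} → Decidable P → ∀ m → 1 ≤ m → P m →
                  ∃ λ n → 1 ≤ n × P n × (∀ k → 1 ≤ k → k < n → ¬ P k)
  least-positive {P = P} P? m = go m (<-wellFounded m)
    where
    go : ∀ m → Acc _<_ m → 1 ≤ m → P m → ∃ λ n → 1 ≤ n × P n × (∀ k → 1 ≤ k → k < n → ¬ P k)
    go m (acc rs) 1≤m Pm with Fin.any? {n = m} (λ i → (1 ≤? toℕ i) ×-dec P? (toℕ i))
    ... | yes (i , 1≤i , Pi) = go (toℕ i) (rs (Fin.toℕ<n i)) 1≤i Pi
    ... | no none = m , 1≤m , Pm , λ k 1≤k k<m Pk →
      none (Fin.fromℕ< k<m , subst (1 ≤_) (sym (Fin.toℕ-fromℕ< k<m)) 1≤k , subst P (sym (Fin.toℕ-fromℕ< k<m)) Pk)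

  injective⇒surjective : ∀ {n} (f : Fin n → Fin n) → (∀ a b → f a ≡ f b → a ≡ b) → ∀ y → ∃ λ x → f x ≡ y
  injective⇒surjective {zero}  f f-inj ()
  injective⇒surjective {suc n} f f-inj y with Fin.any? (λ x → f x Fin.≟ y)
  ... | yes hit = hit
  ... | no miss = ⊥-elim (<⇒≱ (n<1+n n) (Fin.injective⇒≤ {f = g} g-inj))
    where
    y≢f : ∀ x → y ≢ f x
    y≢f x y≡fx = miss (x , sym y≡fx)
    g : Fin (suc n) → Fin n
    g x = Fin.punchOut (y≢f x)
    g-inj : ∀ {a b} → g a ≡ g b → a ≡ b
    g-inj {a} {b} ga≡gb = f-inj a b (Fin.punchOut-injective (y≢f a) (y≢f b) ga≡gb)

module _ {c ℓ} (R : CommutativeRing c ℓ) where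
  private
    R′ : AlmostCommutativeRing c ℓ
    R′ = fromCommutativeRing R (λ _ → nothing)
  open AlmostCommutativeRing R′

  synthetic-division-identity : ∀ a t u r v Q →
    (t + u) * (v + t * Q) + (a + r * v) ≈ a + t * ((t + u) * Q + v) + (u + r) * v
  synthetic-division-identity = solve-∀ R′

module FieldProperties {q : ℕ} (K : FiniteField q) where
  open FiniteField K

  commutativeRing : CommutativeRing _ _
  commutativeRing = record { isCommutativeRing = isCommutativeRing }

  open IsCommutativeRing isCommutativeRing public
    using (+-assoc; +-comm; *-assoc; *-comm; distribˡ; distribʳ; zeroˡ; zeroʳ;
           +-identityˡ; +-identityʳ; *-identityˡ; *-identityʳ; -‿inverseˡ; -‿inverseʳ)
  open import Algebra.Properties.Ring (CommutativeRing.ring commutativeRing) public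
    using (-0#≈0#; +-cancelˡ; -‿involutive; +-inverseʳ-unique; -‿distribˡ-*;
           x∙y⁻¹≈ε⇒x≈y; -‿+-comm; x[y-z]≈xy-xz; x+x≈x⇒x≈0; -1*x≈-x)
  open import Algebra.Properties.CommutativeSemigroup
    (CommutativeRing.+-commutativeSemigroup commutativeRing) public
    using () renaming (interchange to +-interchange)
  open import Algebra.Properties.CommutativeSemigroup
    (CommutativeRing.*-commutativeSemigroup commutativeRing) public
    using () renaming (x∙yz≈y∙xz to x*yz≡y*xz)
  open import Algebra.Properties.Semiring.Mult (CommutativeRing.semiring commutativeRing) public
    using (×-homo-+; ×1-homo-*; ×-assoc-*) renaming (_×_ to _·_)
  open ≡-Reasoning

  infixl 6 _-_
  _-_ : Fin q → Fin q → Fin q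
  a - b = a + - b

  _≟_ : (a b : Fin q) → Dec (a ≡ b)
  _≟_ = Fin._≟_

  1#≢0# : 1# ≢ 0#
  1#≢0# 1≡0 = 0≢1 (sym 1≡0)

  *-cancelˡ : ∀ a b c → a ≢ 0# → a * b ≡ a * c → b ≡ c
  *-cancelˡ a b c a≢0 ab≡ac = begin
    b              ≡⟨ *-identityˡ b ⟨
    1# * b         ≡⟨ cong (_* b) a⁻¹a≡1 ⟨
    (a⁻¹ * a) * b  ≡⟨ *-assoc a⁻¹ a b ⟩
    a⁻¹ * (a * b)  ≡⟨ cong (a⁻¹ *_) ab≡ac ⟩
    a⁻¹ * (a * c)  ≡⟨ *-assoc a⁻¹ a c ⟨
    (a⁻¹ * a) * c  ≡⟨ cong (_* c) a⁻¹a≡1 ⟩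
    1# * c         ≡⟨ *-identityˡ c ⟩
    c              ∎
    where
    a⁻¹ : Fin q
    a⁻¹ = proj₁ (inverse a a≢0)
    a⁻¹a≡1 : a⁻¹ * a ≡ 1#
    a⁻¹a≡1 = trans (*-comm a⁻¹ a) (proj₂ (inverse a a≢0))

  *-cancelʳ : ∀ a b c → a ≢ 0# → b * a ≡ c * a → b ≡ c
  *-cancelʳ a b c a≢0 ba≡ca = *-cancelˡ a b c a≢0 (trans (*-comm a b) (trans ba≡ca (*-comm c a)))

  *≢0 : ∀ {a b} → a ≢ 0# → b ≢ 0# → a * b ≢ 0#
  *≢0 {a} {b} a≢0 b≢0 ab≡0 = b≢0 (*-cancelˡ a b 0# a≢0 (trans ab≡0 (sym (zeroʳ a))))

  *≡0⇒ : ∀ a b → a * b ≡ 0# → a ≡ 0# ⊎ b ≡ 0#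
  *≡0⇒ a b ab≡0 with a ≟ 0# | b ≟ 0#
  ... | yes a≡0 | _       = inj₁ a≡0
  ... | no _    | yes b≡0 = inj₂ b≡0
  ... | no a≢0  | no b≢0  = ⊥-elim (*≢0 a≢0 b≢0 ab≡0)

  pow-+ : ∀ a m k → pow a (m ℕ.+ k) ≡ pow a m * pow a k
  pow-+ a zero    k = sym (*-identityˡ _)
  pow-+ a (suc m) k = trans (cong (a *_) (pow-+ a m k)) (sym (*-assoc a _ _))

  pow-distrib-* : ∀ a b k → pow (a * b) k ≡ pow a k * pow b k
  pow-distrib-* a b zero    = sym (*-identityˡ 1#)
  pow-distrib-* a b (suc k) = begin
    (a * b) * pow (a * b) k            ≡⟨ cong ((a * b) *_) (pow-distrib-* a b k) ⟩
    (a * b) * (pow a k * pow b k)      ≡⟨ *-assoc a b _ ⟩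
    a * (b * (pow a k * pow b k))      ≡⟨ cong (a *_) (trans (sym (*-assoc b _ _)) (cong (_* pow b k) (*-comm b _))) ⟩
    a * ((pow a k * b) * pow b k)      ≡⟨ cong (a *_) (*-assoc (pow a k) b _) ⟩
    a * (pow a k * (b * pow b k))      ≡⟨ *-assoc a _ _ ⟨
    (a * pow a k) * (b * pow b k)      ∎

  pow-* : ∀ a m k → pow a (m ℕ.* k) ≡ pow (pow a m) k
  pow-* a m zero    = cong (pow a) (ℕ.*-zeroʳ m)
  pow-* a m (suc k) = begin
    pow a (m ℕ.* suc k)        ≡⟨ cong (pow a) (ℕ.*-suc m k) ⟩
    pow a (m ℕ.+ m ℕ.* k)      ≡⟨ pow-+ a m (m ℕ.* k) ⟩
    pow a m * pow a (m ℕ.* k)  ≡⟨ cong (pow a m *_) (pow-* a m k) ⟩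
    pow (pow a m) (suc k)      ∎

  pow-identityʳ : ∀ a → pow a 1 ≡ a
  pow-identityʳ = *-identityʳ

  pow-1# : ∀ k → pow 1# k ≡ 1#
  pow-1# zero    = refl
  pow-1# (suc k) = trans (*-identityˡ _) (pow-1# k)

  pow-0# : ∀ k → 0 < k → pow 0# k ≡ 0#
  pow-0# (suc k) _ = zeroˡ _

  pow≢0 : ∀ {a} k → a ≢ 0# → pow a k ≢ 0#
  pow≢0 zero    a≢0 = 1#≢0#
  pow≢0 (suc k) a≢0 = *≢0 a≢0 (pow≢0 k a≢0)

  pow≡0⇒≡0 : ∀ a k → pow a k ≡ 0# → a ≡ 0#
  pow≡0⇒≡0 a k aᵏ≡0 with a ≟ 0#
  ... | yes a≡0 = a≡0
  ... | no a≢0  = ⊥-elim (pow≢0 k a≢0 aᵏ≡0)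

  ι : ℕ → Fin q
  ι m = m · 1#

  ι-+ : ∀ m k → ι (m ℕ.+ k) ≡ ι m + ι k
  ι-+ = ×-homo-+ 1#

  ι-* : ∀ m k → ι (m ℕ.* k) ≡ ι m * ι k
  ι-* = ×1-homo-*

  ι-^ : ∀ m k → ι (m ℕ.^ k) ≡ pow (ι m) k
  ι-^ m zero    = +-identityʳ 1#
  ι-^ m (suc k) = trans (ι-* m (m ℕ.^ k)) (cong (ι m *_) (ι-^ m k))

  ι-*≡0 : ∀ c {m} → ι m ≡ 0# → ι (c ℕ.* m) ≡ 0#
  ι-*≡0 c {m} ιm≡0 = trans (ι-* c m) (trans (cong (ι c *_) ιm≡0) (zeroʳ _))

  ι≡0⇒ι[1+]≢0 : ∀ {a} → ι a ≡ 0# → ι (suc a) ≢ 0#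
  ι≡0⇒ι[1+]≢0 ιa≡0 ι[1+a]≡0 = 1#≢0# (trans (sym (+-identityʳ 1#)) (trans (cong (1# +_) (sym ιa≡0)) ι[1+a]≡0))

  ·≡ι* : ∀ m a → m · a ≡ ι m * a
  ·≡ι* m a = sym (trans (×-assoc-* m 1# a) (cong (m ·_) (*-identityˡ a)))

  -- t ↦ t + 1 permutes the field, so Σ t = Σ (t + 1) = Σ t + q · 1.
  ι[q]≡0 : ι q ≡ 0#
  ι[q]≡0 = +-cancelˡ Σt (ι q) 0# (begin
    Σt + ι q                   ≡⟨ cong (Σt +_) (sum-replicate q) ⟨
    Σt + sum {q} (λ _ → 1#)    ≡⟨ ∑-distrib-+ id (λ _ → 1#) ⟨
    sum {q} (λ t → t + 1#)     ≡⟨ sum-permute id shift ⟨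
    Σt                         ≡⟨ +-identityʳ Σt ⟨
    Σt + 0#                    ∎)
    where
    open import Algebra.Properties.CommutativeMonoid.Sum (CommutativeRing.+-commutativeMonoid commutativeRing)
      using (sum; sum-permute; ∑-distrib-+; sum-replicate)
    Σt : Fin q
    Σt = sum {q} id
    shift : Permutation′ q
    shift = permutation (_+ 1#) (_+ - 1#)
      (λ t → trans (+-assoc t (- 1#) 1#) (trans (cong (t +_) (-‿inverseˡ 1#)) (+-identityʳ t)))
      (λ t → trans (+-assoc t 1# (- 1#)) (trans (cong (t +_) (-‿inverseʳ 1#)) (+-identityʳ t)))

  freshmans-dream : ∀ n → 0 < n → (∀ k → 0 < k → k < n → ι (n C k) ≡ 0#) →
                   ∀ x y → pow (x + y) n ≡ pow x n + pow y n
  freshmans-dream n@(suc m) _ inner≡0 x y = begin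
    pow (x + y) n                             ≡⟨ pow≡^ (x + y) n ⟩
    (x + y) ^ n                               ≡⟨ theorem n x y ⟩
    T fzero + sum (T ∘ fsuc)                  ≡⟨ cong (T fzero +_) (sum-init-last (T ∘ fsuc)) ⟩
    T fzero + (sum (T ∘ fsuc ∘ Fin.inject₁) + T (fsuc (Fin.fromℕ m)))
                                              ≡⟨ cong₂ _+_ first (cong₂ _+_ inner last) ⟩
    pow y n + (0# + pow x n)                  ≡⟨ cong (pow y n +_) (+-identityˡ _) ⟩
    pow y n + pow x n                         ≡⟨ +-comm _ _ ⟩
    pow x n + pow y n                         ∎
    where
    open import Algebra.Properties.CommutativeSemiring.Binomial
      (CommutativeRing.commutativeSemiring commutativeRing) using (theorem; binomialTerm)
    open import Algebra.Properties.Semiring.Sum (CommutativeRing.semiring commutativeRing)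
      using (sum; sum-init-last; sum-cong-≗; sum-replicate-zero)
    open import Algebra.Properties.Semiring.Exp (CommutativeRing.semiring commutativeRing) using (_^_)

    pow≡^ : ∀ a k → pow a k ≡ a ^ k
    pow≡^ a zero    = refl
    pow≡^ a (suc k) = cong (a *_) (pow≡^ a k)

    T : Fin (suc n) → Fin q
    T = binomialTerm x y n

    first : T fzero ≡ pow y n
    first = begin
      (n C 0) · (1# * y ^ n)  ≡⟨ cong (_· (1# * y ^ n)) (trans (nCk≡nC[n∸k] {0} {n} z≤n) (nCn≡1 n)) ⟩
      1# * y ^ n + 0#         ≡⟨ +-identityʳ _ ⟩
      1# * y ^ n              ≡⟨ *-identityˡ _ ⟩
      y ^ n                   ≡⟨ pow≡^ y n ⟨
      pow y n                 ∎

    last : T (fsuc (Fin.fromℕ m)) ≡ pow x n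
    last = begin
      T (fsuc (Fin.fromℕ m))        ≡⟨ cong (λ j → (n C suc j) · (x ^ suc j * y ^ (n ℕ.∸ suc j))) (Fin.toℕ-fromℕ m) ⟩
      (n C n) · (x ^ n * y ^ (n ℕ.∸ n))  ≡⟨ cong (λ c → c · (x ^ n * y ^ (n ℕ.∸ n))) (nCn≡1 n) ⟩
      x ^ n * y ^ (n ℕ.∸ n) + 0#    ≡⟨ +-identityʳ _ ⟩
      x ^ n * y ^ (n ℕ.∸ n)         ≡⟨ cong (λ e → x ^ n * y ^ e) (ℕ.n∸n≡0 n) ⟩
      x ^ n * 1#                    ≡⟨ *-identityʳ _ ⟩
      x ^ n                         ≡⟨ pow≡^ x n ⟨
      pow x n                       ∎

    innerTerm≡0 : ∀ j → T (fsuc (Fin.inject₁ j)) ≡ 0#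
    innerTerm≡0 j = begin
      (n C k) · z   ≡⟨ ·≡ι* (n C k) z ⟩
      ι (n C k) * z ≡⟨ cong (_* z) (inner≡0 k (s≤s z≤n) (s≤s j<m)) ⟩
      0# * z        ≡⟨ zeroˡ z ⟩
      0#            ∎
      where
      k : ℕ
      k = suc (toℕ (Fin.inject₁ j))
      z : Fin q
      z = x ^ k * y ^ (n ℕ.∸ k)
      j<m : toℕ (Fin.inject₁ j) < m
      j<m = subst (_< m) (sym (Fin.toℕ-inject₁ j)) (Fin.toℕ<n j)

    inner : sum (T ∘ fsuc ∘ Fin.inject₁) ≡ 0#
    inner = trans (sum-cong-≗ innerTerm≡0) (sum-replicate-zero m)

  eval : List (Fin q) → Fin q → Fin q
  eval []      t = 0#
  eval (a ∷ P) t = a + t * eval P t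

  NonZeroPoly : List (Fin q) → Set
  NonZeroPoly = Any (_≢ 0#)

  quotient : Fin q → List (Fin q) → List (Fin q)
  quotient r []              = []
  quotient r (a ∷ [])        = []
  quotient r (a ∷ P@(_ ∷ _)) = eval P r ∷ quotient r P

  length-quotient : ∀ r a P → length (quotient r (a ∷ P)) ≡ length P
  length-quotient r a []      = refl
  length-quotient r a (b ∷ P) = cong suc (length-quotient r b P)

  eval-constant : ∀ a t → eval (a ∷ []) t ≡ a
  eval-constant a t = trans (cong (a +_) (zeroʳ t)) (+-identityʳ a)

  eval-quotient : ∀ r P t → eval P t ≡ (t - r) * eval (quotient r P) t + eval P r
  eval-quotient r [] t = sym (trans (cong (_+ 0#) (zeroʳ _)) (+-identityʳ 0#))
  eval-quotient r (a ∷ []) t = begin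
    eval (a ∷ []) t               ≡⟨ trans (eval-constant a t) (sym (eval-constant a r)) ⟩
    eval (a ∷ []) r               ≡⟨ +-identityˡ _ ⟨
    0# + eval (a ∷ []) r          ≡⟨ cong (_+ eval (a ∷ []) r) (zeroʳ (t - r)) ⟨
    (t - r) * 0# + eval (a ∷ []) r ∎
  eval-quotient r (a ∷ P@(_ ∷ _)) t = begin
    a + t * eval P t                              ≡⟨ cong (λ z → a + t * z) (eval-quotient r P t) ⟩
    a + t * ((t - r) * Q + eval P r)              ≡⟨ +-identityʳ _ ⟨
    a + t * ((t - r) * Q + eval P r) + 0#         ≡⟨ cong (a + t * ((t - r) * Q + eval P r) +_) -r+r≡0 ⟨
    a + t * ((t - r) * Q + eval P r) + (- r + r) * eval P r
                                                  ≡⟨ synthetic-division-identity commutativeRing a t (- r) r (eval P r) Q ⟨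
    (t - r) * (eval P r + t * Q) + (a + r * eval P r) ∎
    where
    Q : Fin q
    Q = eval (quotient r P) t
    -r+r≡0 : (- r + r) * eval P r ≡ 0#
    -r+r≡0 = trans (cong (_* eval P r) (-‿inverseˡ r)) (zeroˡ _)

  quotient-nonZero : ∀ r P → NonZeroPoly P → eval P r ≡ 0# → NonZeroPoly (quotient r P)
  quotient-nonZero r (a ∷ []) (here a≢0) Pr≡0 = ⊥-elim (a≢0 (trans (sym (eval-constant a r)) Pr≡0))
  quotient-nonZero r (a ∷ P@(_ ∷ _)) P≢0 aPr≡0 with eval P r ≟ 0# | P≢0
  ... | no Pr≢0 | _          = here Pr≢0
  ... | yes Pr≡0 | there P≢0′ = there (quotient-nonZero r P P≢0′ Pr≡0)
  ... | yes Pr≡0 | here a≢0   = ⊥-elim (a≢0 (begin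
    a                 ≡⟨ +-identityʳ a ⟨
    a + 0#            ≡⟨ cong (a +_) (trans (cong (r *_) Pr≡0) (zeroʳ r)) ⟨
    a + r * eval P r  ≡⟨ aPr≡0 ⟩
    0#                ∎))

  roots<length : ∀ m P → NonZeroPoly P → (f : Fin m → Fin q) → (∀ i j → f i ≡ f j → i ≡ j) →
                 (∀ i → eval P (f i) ≡ 0#) → m < length P
  roots<length m       []      ()
  roots<length zero    (a ∷ P) _   _ _     _    = s≤s z≤n
  roots<length (suc m) (a ∷ P) P≢0 f f-inj root =
    s≤s (subst (m <_) (length-quotient r a P)
      (roots<length m Q (quotient-nonZero r (a ∷ P) P≢0 (root fzero)) (f ∘ fsuc)
        (λ i j fi≡fj → Fin.suc-injective (f-inj (fsuc i) (fsuc j) fi≡fj)) Q-root))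
    where
    r : Fin q
    r = f fzero
    Q : List (Fin q)
    Q = quotient r (a ∷ P)
    Q-root : ∀ i → eval Q (f (fsuc i)) ≡ 0#
    Q-root i with *≡0⇒ (f (fsuc i) - r) (eval Q (f (fsuc i))) (begin
        (f (fsuc i) - r) * eval Q (f (fsuc i))          ≡⟨ +-identityʳ _ ⟨
        (f (fsuc i) - r) * eval Q (f (fsuc i)) + 0#     ≡⟨ cong ((f (fsuc i) - r) * eval Q (f (fsuc i)) +_) (root fzero) ⟨
        (f (fsuc i) - r) * eval Q (f (fsuc i)) + eval (a ∷ P) r
                                                        ≡⟨ eval-quotient r (a ∷ P) (f (fsuc i)) ⟨
        eval (a ∷ P) (f (fsuc i))                       ≡⟨ root (fsuc i) ⟩
        0#                                              ∎)
    ... | inj₂ Q≡0 = Q≡0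
    ... | inj₁ fi-r≡0 with f-inj (fsuc i) fzero (x∙y⁻¹≈ε⇒x≈y _ _ fi-r≡0)
    ...   | ()

  infixl 6 _⊖_
  _⊖_ : List (Fin q) → List (Fin q) → List (Fin q)
  _⊖_ = zipWith _-_

  eval-⊖ : ∀ P Q t → length P ≡ length Q → eval (P ⊖ Q) t ≡ eval P t - eval Q t
  eval-⊖ []      []      t _ = sym (trans (cong (0# +_) -0#≈0#) (+-identityʳ 0#))
  eval-⊖ (a ∷ P) (b ∷ Q) t |P|≡|Q| = begin
    (a - b) + t * eval (P ⊖ Q) t                   ≡⟨ cong (λ z → (a - b) + t * z) (eval-⊖ P Q t (ℕ.suc-injective |P|≡|Q|)) ⟩
    (a - b) + t * (eval P t - eval Q t)            ≡⟨ cong ((a - b) +_) (x[y-z]≈xy-xz t (eval P t) (eval Q t)) ⟩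
    (a - b) + (t * eval P t - t * eval Q t)        ≡⟨ +-interchange a (- b) (t * eval P t) (- (t * eval Q t)) ⟩
    (a + t * eval P t) + (- b + - (t * eval Q t))  ≡⟨ cong ((a + t * eval P t) +_) (-‿+-comm b (t * eval Q t)) ⟩
    (a + t * eval P t) - (b + t * eval Q t)        ∎

  ⊖-nonZero : ∀ P Q → length P ≡ length Q → P ≢ Q → NonZeroPoly (P ⊖ Q)
  ⊖-nonZero []      []      _ P≢Q = ⊥-elim (P≢Q refl)
  ⊖-nonZero (a ∷ P) (b ∷ Q) |P|≡|Q| aP≢bQ with a ≟ b
  ... | no a≢b  = here (λ a-b≡0 → a≢b (x∙y⁻¹≈ε⇒x≈y a b a-b≡0))
  ... | yes refl = there (⊖-nonZero P Q (ℕ.suc-injective |P|≡|Q|) (λ P≡Q → aP≢bQ (cong (a ∷_) P≡Q)))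

  open AffineGroup K using (HasOrder)

  order⇒≢0 : ∀ {x n} → HasOrder x n → x ≢ 0#
  order⇒≢0 {n = suc n} (_ , xⁿ≡1 , _) x≡0 =
    1#≢0# (trans (sym xⁿ≡1) (trans (cong (λ z → pow z (suc n)) x≡0) (pow-0# (suc n) (s≤s z≤n))))

  x*xⁿ⁻¹≡1 : ∀ {x n} → HasOrder x n → x * pow x (n ℕ.∸ 1) ≡ 1#
  x*xⁿ⁻¹≡1 {x} (1≤n , xⁿ≡1 , _) = trans (cong (pow x) (ℕ.m+[n∸m]≡n 1≤n)) xⁿ≡1

  pow-*≡1 : ∀ x n c → pow x n ≡ 1# → pow x (c ℕ.* n) ≡ 1#
  pow-*≡1 x n c xⁿ≡1 = begin
    pow x (c ℕ.* n)  ≡⟨ cong (pow x) (ℕ.*-comm c n) ⟩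
    pow x (n ℕ.* c)  ≡⟨ pow-* x n c ⟩
    pow (pow x n) c  ≡⟨ cong (λ z → pow z c) xⁿ≡1 ⟩
    pow 1# c         ≡⟨ pow-1# c ⟩
    1#               ∎

  pow≡pow⇒pow[∸]≡1 : ∀ {x a b} → x ≢ 0# → a ≤ b → pow x a ≡ pow x b → pow x (b ℕ.∸ a) ≡ 1#
  pow≡pow⇒pow[∸]≡1 {x} {a} {b} x≢0 a≤b xᵃ≡xᵇ = sym (*-cancelˡ (pow x a) 1# _ (pow≢0 a x≢0) (begin
    pow x a * 1#                ≡⟨ *-identityʳ _ ⟩
    pow x a                     ≡⟨ xᵃ≡xᵇ ⟩
    pow x b                     ≡⟨ cong (pow x) (ℕ.m+[n∸m]≡n a≤b) ⟨
    pow x (a ℕ.+ (b ℕ.∸ a))     ≡⟨ pow-+ x a (b ℕ.∸ a) ⟩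
    pow x a * pow x (b ℕ.∸ a)   ∎))

  order∣ : ∀ {x n} → HasOrder x n → ∀ k → pow x k ≡ 1# → n ∣ k
  order∣ {x} {n@(suc _)} (_ , xⁿ≡1 , minimal) k xᵏ≡1 with k % n ℕ.≟ 0
  ... | yes k%n≡0 = m%n≡0⇒n∣m k n k%n≡0
  ... | no k%n≢0  = ⊥-elim (minimal (k % n) (ℕ.n≢0⇒n>0 k%n≢0) (m%n<n k n) (begin
    pow x (k % n)                          ≡⟨ *-identityʳ _ ⟨
    pow x (k % n) * 1#                     ≡⟨ cong (pow x (k % n) *_) (pow-*≡1 x n (k / n) xⁿ≡1) ⟨
    pow x (k % n) * pow x (k / n ℕ.* n)    ≡⟨ pow-+ x (k % n) _ ⟨
    pow x (k % n ℕ.+ k / n ℕ.* n)          ≡⟨ cong (pow x) (m≡m%n+[m/n]*n k n) ⟨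
    pow x k                                ≡⟨ xᵏ≡1 ⟩
    1#                                     ∎))

  order∣∸ : ∀ {x n a b} → HasOrder x n → a ≤ b → pow x a ≡ pow x b → n ∣ b ℕ.∸ a
  order∣∸ x∈n a≤b xᵃ≡xᵇ = order∣ x∈n _ (pow≡pow⇒pow[∸]≡1 (order⇒≢0 x∈n) a≤b xᵃ≡xᵇ)

  pow-injective : ∀ {x n a b} → HasOrder x n → a < n → b < n → pow x a ≡ pow x b → a ≡ b
  pow-injective {x} {n} {a} {b} x∈n@(_ , _ , minimal) a<n b<n xᵃ≡xᵇ with ℕ.<-cmp a b
  ... | tri≈ _ a≡b _ = a≡b
  ... | tri< a<b _ _ = ⊥-elim (minimal (b ℕ.∸ a) (ℕ.m<n⇒0<n∸m a<b) (ℕ.≤-<-trans (ℕ.m∸n≤m b a) b<n)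
                                (pow≡pow⇒pow[∸]≡1 (order⇒≢0 x∈n) (ℕ.<⇒≤ a<b) xᵃ≡xᵇ))
  ... | tri> _ _ b<a = ⊥-elim (minimal (a ℕ.∸ b) (ℕ.m<n⇒0<n∸m b<a) (ℕ.≤-<-trans (ℕ.m∸n≤m a b) a<n)
                                (pow≡pow⇒pow[∸]≡1 (order⇒≢0 x∈n) (ℕ.<⇒≤ b<a) (sym xᵃ≡xᵇ)))

  order>1⇒≢1 : ∀ {x n} → HasOrder x n → 1 < n → x ≢ 1#
  order>1⇒≢1 {x} (_ , _ , minimal) 1<n x≡1 = minimal 1 ℕ.≤-refl 1<n (trans (pow-identityʳ x) x≡1)

  order-pow : ∀ {t} c m → HasOrder t (c ℕ.* m) → 1 ≤ c → HasOrder (pow t c) m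
  order-pow c zero (1≤c*0 , _) _ = ⊥-elim (ℕ.<⇒≱ 1≤c*0 (ℕ.≤-reflexive (ℕ.*-zeroʳ c)))
  order-pow {t} c (suc m) (_ , tᶜᵐ≡1 , minimal) 1≤c =
    s≤s z≤n , trans (sym (pow-* t c (suc m))) tᶜᵐ≡1 ,
    λ k 1≤k k<m tᶜᵏ≡1 → minimal (c ℕ.* k) (ℕ.*-mono-≤ 1≤c 1≤k)
                          (ℕ.*-monoʳ-< c {{ℕ.>-nonZero 1≤c}} k<m) (trans (pow-* t c k) tᶜᵏ≡1)

  order-* : ∀ {u v r s} → HasOrder u r → HasOrder v s → Coprime r s → HasOrder (u * v) (r ℕ.* s)
  order-* {u} {v} {r} {s} u∈r@(1≤r , uʳ≡1 , _) v∈s@(1≤s , vˢ≡1 , _) r⊥s =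
    ℕ.*-mono-≤ 1≤r 1≤s ,
    trans (pow-distrib-* u v (r ℕ.* s))
      (trans (cong₂ _*_ (trans (cong (pow u) (ℕ.*-comm r s)) (pow-*≡1 u r s uʳ≡1)) (pow-*≡1 v s r vˢ≡1))
             (*-identityˡ 1#)) ,
    λ k 1≤k k<rs [uv]ᵏ≡1 → ℕ.<⇒≱ k<rs (∣⇒≤ {{ℕ.>-nonZero 1≤k}}
      (coprime⇒*∣ r⊥s (r∣k [uv]ᵏ≡1) (s∣k [uv]ᵏ≡1)))
    where
    [uv]ᵐᵏ≡1 : ∀ {k} m → pow (u * v) k ≡ 1# → pow (u * v) (k ℕ.* m) ≡ 1#
    [uv]ᵐᵏ≡1 {k} m [uv]ᵏ≡1 = trans (cong (pow (u * v)) (ℕ.*-comm k m)) (pow-*≡1 (u * v) k m [uv]ᵏ≡1)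
    r∣k : ∀ {k} → pow (u * v) k ≡ 1# → r ∣ k
    r∣k {k} [uv]ᵏ≡1 = coprime-divisor r⊥s (subst (r ∣_) (ℕ.*-comm k s) (order∣ u∈r (k ℕ.* s) (begin
      pow u (k ℕ.* s)                        ≡⟨ *-identityʳ _ ⟨
      pow u (k ℕ.* s) * 1#                   ≡⟨ cong (pow u (k ℕ.* s) *_) (pow-*≡1 v s k vˢ≡1) ⟨
      pow u (k ℕ.* s) * pow v (k ℕ.* s)      ≡⟨ pow-distrib-* u v (k ℕ.* s) ⟨
      pow (u * v) (k ℕ.* s)                  ≡⟨ [uv]ᵐᵏ≡1 {k} s [uv]ᵏ≡1 ⟩
      1#                                     ∎)))
    s∣k : ∀ {k} → pow (u * v) k ≡ 1# → s ∣ k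
    s∣k {k} [uv]ᵏ≡1 = coprime-divisor (Coprime.sym r⊥s) (subst (s ∣_) (ℕ.*-comm k r) (order∣ v∈s (k ℕ.* r) (begin
      pow v (k ℕ.* r)                        ≡⟨ *-identityˡ _ ⟨
      1# * pow v (k ℕ.* r)                   ≡⟨ cong (_* pow v (k ℕ.* r)) (pow-*≡1 u r k uʳ≡1) ⟨
      pow u (k ℕ.* r) * pow v (k ℕ.* r)      ≡⟨ pow-distrib-* u v (k ℕ.* r) ⟨
      pow (u * v) (k ℕ.* r)                  ≡⟨ [uv]ᵐᵏ≡1 {k} r [uv]ᵏ≡1 ⟩
      1#                                     ∎)))

  order<q : ∀ {x n} → HasOrder x n → n < q
  order<q {x} {n} x∈n = Fin.injective⇒≤ {f = f} f-inj
    where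
    f : Fin (suc n) → Fin q
    f fzero    = 0#
    f (fsuc i) = pow x (toℕ i)
    f-inj : ∀ {i j} → f i ≡ f j → i ≡ j
    f-inj {fzero}  {fzero}  _   = refl
    f-inj {fzero}  {fsuc j} eq  = ⊥-elim (pow≢0 (toℕ j) (order⇒≢0 x∈n) (sym eq))
    f-inj {fsuc i} {fzero}  eq  = ⊥-elim (pow≢0 (toℕ i) (order⇒≢0 x∈n) eq)
    f-inj {fsuc i} {fsuc j} eq  =
      cong fsuc (Fin.toℕ-injective (pow-injective x∈n (Fin.toℕ<n i) (Fin.toℕ<n j) eq))

  order-exists : ∀ x → x ≢ 0# → ∃ (HasOrder x)
  order-exists x x≢0 with Fin.pigeonhole (ℕ.n<1+n q) (λ i → pow x (toℕ i))
  ... | i , j , i<j , xⁱ≡xʲ =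
    least-positive (λ k → pow x k ≟ 1#) (toℕ j ℕ.∸ toℕ i) (ℕ.m<n⇒0<n∸m i<j)
      (pow≡pow⇒pow[∸]≡1 x≢0 (ℕ.<⇒≤ i<j) xⁱ≡xʲ)

  IsExponent : ℕ → Set
  IsExponent e = ∀ t → t ≢ 0# → pow t e ≡ 1#

  -- If t^e ≢ 1, a prime ℓ occurs in the order r of t to a higher power ℓ^a than in e = ℓ^b m;
  -- then t^(r/ℓ^a) of order ℓ^a and g^(ℓ^b) of the coprime order m multiply to order ℓ^a m > e.
  larger-order : ∀ {g e} → HasOrder g e → ¬ IsExponent e → ∃₂ λ g′ e′ → HasOrder g′ e′ × e < e′
  larger-order {g} {e} g∈e@(1≤e , _) ¬exp
    with Fin.¬∀⟶∃¬ q _ (λ t → ¬? (t ≟ 0#) →-dec (pow t e ≟ 1#)) ¬exp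
  ... | t , tᵉ≢1 with t ≟ 0#
  ...   | yes t≡0 = ⊥-elim (tᵉ≢1 (λ t≢0 → ⊥-elim (t≢0 t≡0)))
  ...   | no t≢0 with order-exists t t≢0
  ...     | r , t∈r@(1≤r , tʳ≡1 , _)
    with ∤⇒excessPrimePower r e 1≤r 1≤e (λ { (divides c e≡cr) → tᵉ≢1 (λ _ →
           trans (cong (pow t) e≡cr) (pow-*≡1 t r c tʳ≡1)) })
  ...       | mkExcess {ℓ} {a} ℓ-prime (divides c r≡cℓᵃ) (mkValuation b m e≡ℓᵇm ℓ∤m) b<a =
    pow t c * pow g (ℓ ℕ.^ b) , ℓ ℕ.^ a ℕ.* m ,
    order-* tᶜ∈ℓᵃ gˡᵇ∈m (coprime-^ (prime∤⇒coprime ℓ-prime ℓ∤m) a) ,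
    subst (_< ℓ ℕ.^ a ℕ.* m) (sym e≡ℓᵇm)
      (ℕ.*-monoˡ-< m {{ℕ.>-nonZero 1≤m}} (ℕ.^-monoʳ-< ℓ (prime⇒>1 ℓ-prime) b<a))
    where
    1≤m : 1 ≤ m
    1≤m = ℕ.n≢0⇒n>0 λ { refl → ℕ.<⇒≢ 1≤e (sym (trans e≡ℓᵇm (ℕ.*-zeroʳ (ℓ ℕ.^ b)))) }
    1≤c : 1 ≤ c
    1≤c = ℕ.n≢0⇒n>0 λ { refl → ℕ.<⇒≢ 1≤r (sym r≡cℓᵃ) }
    tᶜ∈ℓᵃ : HasOrder (pow t c) (ℓ ℕ.^ a)
    tᶜ∈ℓᵃ = order-pow c (ℓ ℕ.^ a) (subst (HasOrder t) r≡cℓᵃ t∈r) 1≤c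
    gˡᵇ∈m : HasOrder (pow g (ℓ ℕ.^ b)) m
    gˡᵇ∈m = order-pow (ℓ ℕ.^ b) m (subst (HasOrder g) e≡ℓᵇm g∈e)
              (ℕ.m^n>0 ℓ {{prime⇒nonZero ℓ-prime}} b)

  element-of-exponent-order : ∃₂ λ g e → HasOrder g e × IsExponent e
  element-of-exponent-order = go one-order (<-wellFounded (q ℕ.∸ 1))
    where
    one-order : HasOrder 1# 1
    one-order = s≤s z≤n , *-identityʳ 1# , λ k 1≤k k<1 _ → ℕ.<⇒≱ k<1 1≤k
    go : ∀ {g e} → HasOrder g e → Acc _<_ (q ℕ.∸ e) → ∃₂ λ g e → HasOrder g e × IsExponent e
    go {g} {e} g∈e (acc rs) with Fin.all? (λ t → ¬? (t ≟ 0#) →-dec (pow t e ≟ 1#))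
    ... | yes e-exp = g , e , g∈e , e-exp
    ... | no ¬exp with larger-order g∈e ¬exp
    ...   | g′ , e′ , g′∈e′ , e<e′ = go g′∈e′ (rs (ℕ.∸-monoʳ-< e<e′ (ℕ.<⇒≤ (order<q g′∈e′))))

  monomial : ℕ → List (Fin q)
  monomial k = replicate k 0# ++ 1# ∷ []

  eval-monomial : ∀ k t → eval (monomial k) t ≡ pow t k
  eval-monomial zero    t = eval-constant 1# t
  eval-monomial (suc k) t = trans (+-identityˡ _) (cong (t *_) (eval-monomial k t))

  length-monomial : ∀ k → length (monomial k) ≡ suc k
  length-monomial zero    = refl
  length-monomial (suc k) = cong suc (length-monomial k)

  exponent⇒q≤1+e : ∀ e → IsExponent e → 1 ≤ e → q ≤ suc e
  exponent⇒q≤1+e (suc e) exp _ = ℕ.≤-pred (subst (q <_) (cong (suc ∘ suc) (length-monomial e))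
      (roots<length q P (there (here -1≢0)) id (λ _ _ eq → eq) root))
    where
    -1≢0 : - 1# ≢ 0#
    -1≢0 -1≡0 = 1#≢0# (trans (sym (-‿involutive 1#)) (trans (cong -_ -1≡0) -0#≈0#))
    P : List (Fin q)
    P = 0# ∷ - 1# ∷ monomial e  -- t (t^(1+e) − 1)
    root : ∀ t → eval P t ≡ 0#
    root t with t ≟ 0#
    ... | yes t≡0 = trans (+-identityˡ _) (trans (cong (_* eval (- 1# ∷ monomial e) t) t≡0) (zeroˡ _))
    ... | no t≢0  = begin
      0# + t * (- 1# + t * eval (monomial e) t)  ≡⟨ +-identityˡ _ ⟩
      t * (- 1# + t * eval (monomial e) t)       ≡⟨ cong (λ z → t * (- 1# + t * z)) (eval-monomial e t) ⟩
      t * (- 1# + pow t (suc e))                 ≡⟨ cong (λ z → t * (- 1# + z)) (exp t t≢0) ⟩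
      t * (- 1# + 1#)                            ≡⟨ cong (t *_) (-‿inverseˡ 1#) ⟩
      t * 0#                                     ≡⟨ zeroʳ t ⟩
      0#                                         ∎

  primitive-element : ∃₂ λ g e → HasOrder g e × suc e ≡ q
  primitive-element with element-of-exponent-order
  ... | g , e , g∈e , e-exp = g , e , g∈e , ℕ.≤-antisym (order<q g∈e) (exponent⇒q≤1+e e e-exp (proj₁ g∈e))

  element-of-order : ∀ {n} → n ∣ q ℕ.∸ 1 → ∃ λ x → HasOrder x n
  element-of-order {n} (divides c q-1≡cn) with primitive-element
  ... | g , e , g∈e@(1≤e , _) , 1+e≡q = pow g c , order-pow c n (subst (HasOrder g) e≡cn g∈e) 1≤c
    where
    e≡cn : e ≡ c ℕ.* n
    e≡cn = trans (cong ℕ.pred 1+e≡q) q-1≡cn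
    1≤c : 1 ≤ c
    1≤c = ℕ.n≢0⇒n>0 λ { refl → ℕ.<⇒≢ 1≤e (sym e≡cn) }

module AffineGroupProperties {q : ℕ} (K : FiniteField q) where
  open FiniteField K
  open FieldProperties K
  open AffineGroup K
  open ≡-Reasoning

  τ : Fin q → Aff
  τ b = (1# , b)

  τ∘τ : ∀ a b → τ a ∘ₐ τ b ≡ τ (b + a)
  τ∘τ a b = cong₂ _,_ (*-identityˡ 1#) (cong (_+ a) (*-identityˡ b))

  dilation∘τ : ∀ x c → (x , 0#) ∘ₐ τ c ≡ τ (x * c) ∘ₐ (x , 0#)
  dilation∘τ x c = cong₂ _,_ (trans (*-identityʳ x) (sym (*-identityˡ x)))
    (trans (+-identityʳ _) (trans (sym (+-identityˡ _)) (cong (_+ x * c) (sym (zeroʳ 1#)))))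

  isInv : ∀ {a b a′ b′} → a * a′ ≡ 1# → a * b′ + b ≡ 0# → a′ * b + b′ ≡ 0# → IsInv (a , b) (a′ , b′)
  isInv {a} {a′ = a′} aa′≡1 ab′+b≡0 a′b+b′≡0 =
    cong₂ _,_ aa′≡1 ab′+b≡0 , cong₂ _,_ (trans (*-comm a′ a) aa′≡1) a′b+b′≡0

  module TranslationPart {n x y} (x∈n : HasOrder x n) (x≢1 : x ≢ 1#) (real : Real x y) where
    φ : Aff → Aff
    φ = proj₁ real

    φ-closed : ∀ g → InG x g → InG x (φ g)
    φ-closed = proj₁ (proj₂ real)

    φ-hom : ∀ g h → InG x g → InG x h → φ (g ∘ₐ h) ≡ φ g ∘ₐ φ h
    φ-hom = proj₁ (proj₂ (proj₂ real))

    φ-injective : ∀ g h → InG x g → InG x h → φ g ≡ φ h → g ≡ h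
    φ-injective = proj₁ (proj₂ (proj₂ (proj₂ real)))

    φx-inverse : IsInv (x , 0#) (φ (x , 0#))
    φx-inverse = proj₁ (proj₂ (proj₂ (proj₂ (proj₂ (proj₂ real)))))

    x⁻¹ : Fin q
    x⁻¹ = pow x (n ℕ.∸ 1)


    x≢0 : x ≢ 0#
    x≢0 = order⇒≢0 x∈n

    φx≡x⁻¹ : φ (x , 0#) ≡ (x⁻¹ , 0#)
    φx≡x⁻¹ = cong₂ _,_
      (*-cancelˡ x _ x⁻¹ x≢0 (trans (cong proj₁ (proj₁ φx-inverse)) (sym (x*xⁿ⁻¹≡1 x∈n))))
      (*-cancelˡ x _ 0# x≢0 (trans (sym (+-identityʳ _)) (trans (cong proj₂ (proj₁ φx-inverse)) (sym (zeroʳ x)))))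

    G-τ : ∀ b → InG x (τ b)
    G-τ b = 0 , refl

    G-x : InG x (x , 0#)
    G-x = 1 , sym (pow-identityʳ x)

    ψ : Aff → Fin q
    ψ g = proj₁ (φ g)

    ψ-hom : ∀ g h → InG x g → InG x h → ψ (g ∘ₐ h) ≡ ψ g * ψ h
    ψ-hom g h g∈G h∈G = cong proj₁ (φ-hom g h g∈G h∈G)

    ψ≢0 : ∀ g → InG x g → ψ g ≢ 0#
    ψ≢0 g g∈G ψg≡0 with φ-closed g g∈G
    ... | k , ψg≡xᵏ = pow≢0 k x≢0 (trans (sym ψg≡xᵏ) ψg≡0)

    ψτ-dilation-invariant : ∀ c → ψ (τ c) ≡ ψ (τ (x * c))
    ψτ-dilation-invariant c = *-cancelˡ x⁻¹ _ _ (pow≢0 (n ℕ.∸ 1) x≢0) (begin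
      x⁻¹ * ψ (τ c)                ≡⟨ cong (λ g → proj₁ g * ψ (τ c)) φx≡x⁻¹ ⟨
      ψ (x , 0#) * ψ (τ c)         ≡⟨ ψ-hom (x , 0#) (τ c) G-x (G-τ c) ⟨
      ψ ((x , 0#) ∘ₐ τ c)          ≡⟨ cong ψ (dilation∘τ x c) ⟩
      ψ (τ (x * c) ∘ₐ (x , 0#))    ≡⟨ ψ-hom (τ (x * c)) (x , 0#) (G-τ (x * c)) G-x ⟩
      ψ (τ (x * c)) * ψ (x , 0#)   ≡⟨ cong (λ g → ψ (τ (x * c)) * proj₁ g) φx≡x⁻¹ ⟩
      ψ (τ (x * c)) * x⁻¹          ≡⟨ *-comm _ x⁻¹ ⟩
      x⁻¹ * ψ (τ (x * c))          ∎)

    -- ψ ∘ τ is invariant under c ↦ x c, hence trivial on every x c − c, and these are all of 𝔽_q.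
    ψτ≡1 : ∀ b → ψ (τ b) ≡ 1#
    ψτ≡1 b = sym (*-cancelʳ (ψ (τ c)) 1# _ (ψ≢0 (τ c) (G-τ c)) (begin
      1# * ψ (τ c)                   ≡⟨ *-identityˡ _ ⟩
      ψ (τ c)                        ≡⟨ ψτ-dilation-invariant c ⟩
      ψ (τ (x * c))                  ≡⟨ cong (ψ ∘ τ) c+b≡xc ⟨
      ψ (τ (c + b))                  ≡⟨ cong ψ (τ∘τ b c) ⟨
      ψ (τ b ∘ₐ τ c)                 ≡⟨ ψ-hom (τ b) (τ c) (G-τ b) (G-τ c) ⟩
      ψ (τ b) * ψ (τ c)              ∎))
      where
      x-1≢0 : x - 1# ≢ 0#
      x-1≢0 x-1≡0 = x≢1 (x∙y⁻¹≈ε⇒x≈y x 1# x-1≡0)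
      c : Fin q
      c = b * proj₁ (inverse (x - 1#) x-1≢0)
      [x-1]c≡b : (x - 1#) * c ≡ b
      [x-1]c≡b = begin
        (x - 1#) * (b * _)   ≡⟨ cong ((x - 1#) *_) (*-comm b _) ⟩
        (x - 1#) * (_ * b)   ≡⟨ *-assoc (x - 1#) _ b ⟨
        ((x - 1#) * _) * b   ≡⟨ cong (_* b) (proj₂ (inverse (x - 1#) x-1≢0)) ⟩
        1# * b               ≡⟨ *-identityˡ b ⟩
        b                    ∎
      c+b≡xc : c + b ≡ x * c
      c+b≡xc = begin
        c + b                        ≡⟨ cong (c +_) [x-1]c≡b ⟨
        c + (x - 1#) * c             ≡⟨ cong (c +_) (distribʳ c x (- 1#)) ⟩
        c + (x * c + - 1# * c)       ≡⟨ cong (λ z → c + (x * c + z)) (-1*x≈-x c) ⟩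
        c + (x * c + - c)            ≡⟨ +-comm c _ ⟩
        (x * c + - c) + c            ≡⟨ +-assoc (x * c) (- c) c ⟩
        x * c + (- c + c)            ≡⟨ cong (x * c +_) (-‿inverseˡ c) ⟩
        x * c + 0#                   ≡⟨ +-identityʳ _ ⟩
        x * c                        ∎

    translation-part : Fin q → Fin q
    translation-part b = proj₂ (φ (τ b))

    φτ≡τ : ∀ b → φ (τ b) ≡ τ (translation-part b)
    φτ≡τ b = cong₂ _,_ (ψτ≡1 b) refl

    translation-part-+ : ∀ a b → translation-part (a + b) ≡ translation-part a + translation-part b
    translation-part-+ a b = begin
      proj₂ (φ (τ (a + b)))           ≡⟨ cong (proj₂ ∘ φ) (τ∘τ b a) ⟨
      proj₂ (φ (τ b ∘ₐ τ a))          ≡⟨ cong proj₂ (φ-hom (τ b) (τ a) (G-τ b) (G-τ a)) ⟩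
      proj₂ (φ (τ b) ∘ₐ φ (τ a))      ≡⟨ cong₂ (λ g h → proj₂ (g ∘ₐ h)) (φτ≡τ b) (φτ≡τ a) ⟩
      1# * translation-part a + translation-part b ≡⟨ cong (_+ translation-part b) (*-identityˡ _) ⟩
      translation-part a + translation-part b ∎

    translation-part-injective : ∀ a b → translation-part a ≡ translation-part b → a ≡ b
    translation-part-injective a b fa≡fb =
      cong proj₂ (φ-injective (τ a) (τ b) (G-τ a) (G-τ b) (trans (φτ≡τ a) (trans (cong τ fa≡fb) (sym (φτ≡τ b)))))

    translation-part-x : ∀ b → translation-part (x * b) ≡ x⁻¹ * translation-part b
    translation-part-x b = sym (begin
      x⁻¹ * translation-part b                       ≡⟨ +-identityʳ _ ⟨
      x⁻¹ * translation-part b + 0#                  ≡⟨ cong₂ (λ g h → proj₂ (g ∘ₐ h)) φx≡x⁻¹ (φτ≡τ b) ⟨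
      proj₂ (φ (x , 0#) ∘ₐ φ (τ b))                  ≡⟨ cong proj₂ (φ-hom (x , 0#) (τ b) G-x (G-τ b)) ⟨
      proj₂ (φ ((x , 0#) ∘ₐ τ b))                    ≡⟨ cong (proj₂ ∘ φ) (dilation∘τ x b) ⟩
      proj₂ (φ (τ (x * b) ∘ₐ (x , 0#)))              ≡⟨ cong proj₂ (φ-hom (τ (x * b)) (x , 0#) (G-τ (x * b)) G-x) ⟩
      proj₂ (φ (τ (x * b)) ∘ₐ φ (x , 0#))            ≡⟨ cong₂ (λ g h → proj₂ (g ∘ₐ h)) (φτ≡τ (x * b)) φx≡x⁻¹ ⟩
      1# * 0# + translation-part (x * b)             ≡⟨ trans (cong (_+ _) (zeroʳ 1#)) (+-identityˡ _) ⟩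
      translation-part (x * b)                       ∎)

module PrimePowerField (p d : ℕ) (p-prime : Prime p) (K : FiniteField (p ℕ.^ d)) where
  open FiniteField K
  open FieldProperties K
  open AffineGroup K using (HasOrder)
  open ≡-Reasoning

  private
    instance
      p≢0 : ℕ.NonZero p
      p≢0 = prime⇒nonZero p-prime

  𝔽 : Set
  𝔽 = Fin (p ℕ.^ d)

  ι[p]≡0 : ι p ≡ 0#
  ι[p]≡0 = pow≡0⇒≡0 (ι p) d (trans (sym (ι-^ p d)) ι[q]≡0)

  -- Bézout writes 1 + y m = x p or 1 + x p = y m, and both sides would vanish if ι m did.
  ι≢0 : ∀ m → 0 < m → m < p → ι m ≢ 0#
  ι≢0 m@(suc _) _ m<p ιm≡0 with coprime-Bézout (prime⇒coprime p-prime m<p)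
  ... | Bézout.+- x y 1+ym≡xp =
    ι≡0⇒ι[1+]≢0 {y ℕ.* m} (ι-*≡0 y ιm≡0) (trans (cong ι 1+ym≡xp) (ι-*≡0 x ι[p]≡0))
  ... | Bézout.-+ x y 1+xp≡ym =
    ι≡0⇒ι[1+]≢0 {x ℕ.* p} (ι-*≡0 x ι[p]≡0) (trans (cong ι 1+xp≡ym) (ι-*≡0 y ιm≡0))

  ι-<⇒≢ : ∀ {a b} → a < b → b < p → ι a ≢ ι b
  ι-<⇒≢ {a} {b} a<b b<p ιa≡ιb =
    ι≢0 (b ℕ.∸ a) (ℕ.m<n⇒0<n∸m a<b) (ℕ.≤-<-trans (ℕ.m∸n≤m b a) b<p)
      (sym (+-cancelˡ (ι a) 0# (ι (b ℕ.∸ a)) (begin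
        ι a + 0#               ≡⟨ +-identityʳ (ι a) ⟩
        ι a                    ≡⟨ ιa≡ιb ⟩
        ι b                    ≡⟨ cong ι (ℕ.m+[n∸m]≡n (ℕ.<⇒≤ a<b)) ⟨
        ι (a ℕ.+ (b ℕ.∸ a))    ≡⟨ ι-+ a (b ℕ.∸ a) ⟩
        ι a + ι (b ℕ.∸ a)      ∎)))

  ι-injective : ∀ {a b} → a < p → b < p → ι a ≡ ι b → a ≡ b
  ι-injective {a} {b} a<p b<p ιa≡ιb with ℕ.<-cmp a b
  ... | tri< a<b _ _ = ⊥-elim (ι-<⇒≢ a<b b<p ιa≡ιb)
  ... | tri≈ _ a≡b _ = a≡b
  ... | tri> _ _ b<a = ⊥-elim (ι-<⇒≢ b<a a<p (sym ιa≡ιb))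

  InPrimeField : 𝔽 → Set
  InPrimeField c = ∃ λ m → c ≡ ι m

  -ι≡ι : ∀ m → - ι m ≡ ι (ℕ.pred p ℕ.* m)
  -ι≡ι m = sym (+-inverseʳ-unique (ι m) _ (begin
    ι m + ι (ℕ.pred p ℕ.* m)  ≡⟨ ι-+ m (ℕ.pred p ℕ.* m) ⟨
    ι (suc (ℕ.pred p) ℕ.* m)  ≡⟨ cong (λ z → ι (z ℕ.* m)) (ℕ.suc-pred p) ⟩
    ι (p ℕ.* m)               ≡⟨ cong ι (ℕ.*-comm p m) ⟩
    ι (m ℕ.* p)               ≡⟨ ι-*≡0 m ι[p]≡0 ⟩
    0#                        ∎))

  InPrimeField-− : ∀ {a b} → InPrimeField a → InPrimeField b → InPrimeField (a - b)
  InPrimeField-− {a} {b} (m , a≡ιm) (k , b≡ιk) = m ℕ.+ ℕ.pred p ℕ.* k , (begin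
    a - b                       ≡⟨ cong₂ (λ u v → u - v) a≡ιm b≡ιk ⟩
    ι m - ι k                   ≡⟨ cong (ι m +_) (-ι≡ι k) ⟩
    ι m + ι (ℕ.pred p ℕ.* k)    ≡⟨ ι-+ m _ ⟨
    ι (m ℕ.+ ℕ.pred p ℕ.* k)    ∎)

  frobenius-+ : ∀ x y → pow (x + y) p ≡ pow x p + pow y p
  frobenius-+ = freshmans-dream p (ℕ.>-nonZero⁻¹ p) ι[pCk]≡0
    where
    ι[pCk]≡0 : ∀ k → 0 < k → k < p → ι (p C k) ≡ 0#
    ι[pCk]≡0 k 0<k k<p with prime∣choose p-prime 0<k k<p
    ... | divides c pCk≡cp = trans (cong ι pCk≡cp) (ι-*≡0 c ι[p]≡0)

  frob : ℕ → 𝔽 → 𝔽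
  frob k t = pow t (p ℕ.^ k)

  frob-suc : ∀ k t → frob (suc k) t ≡ frob k (pow t p)
  frob-suc k t = pow-* t p (p ℕ.^ k)

  frob-+ : ∀ k x y → frob k (x + y) ≡ frob k x + frob k y
  frob-+ zero    x y = trans (pow-identityʳ _) (sym (cong₂ _+_ (pow-identityʳ x) (pow-identityʳ y)))
  frob-+ (suc k) x y = begin
    frob (suc k) (x + y)               ≡⟨ frob-suc k (x + y) ⟩
    frob k (pow (x + y) p)             ≡⟨ cong (frob k) (frobenius-+ x y) ⟩
    frob k (pow x p + pow y p)         ≡⟨ frob-+ k _ _ ⟩
    frob k (pow x p) + frob k (pow y p) ≡⟨ cong₂ _+_ (frob-suc k x) (frob-suc k y) ⟨
    frob (suc k) x + frob (suc k) y    ∎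

  frob-* : ∀ k x y → frob k (x * y) ≡ frob k x * frob k y
  frob-* k x y = pow-distrib-* x y (p ℕ.^ k)

  frob-pow : ∀ k t j → frob k (pow t j) ≡ pow (frob k t) j
  frob-pow k t j = trans (sym (pow-* t j (p ℕ.^ k))) (trans (cong (pow t) (ℕ.*-comm j (p ℕ.^ k))) (pow-* t (p ℕ.^ k) j))

  frob-0# : ∀ k → frob k 0# ≡ 0#
  frob-0# k = pow-0# (p ℕ.^ k) (ℕ.m^n>0 p k)

  frob-ι : ∀ k m → frob k (ι m) ≡ ι m
  frob-ι k zero    = frob-0# k
  frob-ι k (suc m) = trans (frob-+ k 1# (ι m)) (cong₂ _+_ (pow-1# (p ℕ.^ k)) (frob-ι k m))

  frob-neg : ∀ k x → frob k (- x) ≡ - frob k x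
  frob-neg k x = +-inverseʳ-unique (frob k x) (frob k (- x))
    (trans (sym (frob-+ k x (- x))) (trans (cong (frob k) (-‿inverseʳ x)) (frob-0# k)))

  frob-injective : ∀ k {a b} → frob k a ≡ frob k b → a ≡ b
  frob-injective k {a} {b} σa≡σb = x∙y⁻¹≈ε⇒x≈y a b (pow≡0⇒≡0 _ (p ℕ.^ k) (begin
    frob k (a - b)           ≡⟨ frob-+ k a (- b) ⟩
    frob k a + frob k (- b)  ≡⟨ cong (frob k a +_) (frob-neg k b) ⟩
    frob k a - frob k b      ≡⟨ cong (_- frob k b) σa≡σb ⟩
    frob k b - frob k b      ≡⟨ -‿inverseʳ _ ⟩
    0#                       ∎))

  frob-surjective : ∀ k y → ∃ λ x → frob k x ≡ y
  frob-surjective k = injective⇒surjective (frob k) (λ _ _ → frob-injective k)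

  frob-eval : ∀ k {P} → All InPrimeField P → ∀ t → frob k (eval P t) ≡ eval P (frob k t)
  frob-eval k []                  t = frob-0# k
  frob-eval k {c ∷ P} ((m , c≡ιm) ∷ P∈𝔽ₚ) t = begin
    frob k (c + t * eval P t)                  ≡⟨ frob-+ k c _ ⟩
    frob k c + frob k (t * eval P t)           ≡⟨ cong₂ _+_ (trans (cong (frob k) c≡ιm) (trans (frob-ι k m) (sym c≡ιm))) (frob-* k t _) ⟩
    c + frob k t * frob k (eval P t)           ≡⟨ cong (λ z → c + frob k t * z) (frob-eval k P∈𝔽ₚ t) ⟩
    c + frob k t * eval P (frob k t)           ∎

  digits : ∀ m → Fin (p ℕ.^ m) → List (𝔽)
  digits zero    _ = []
  digits (suc m) i = ι (toℕ (proj₁ (Fin.remQuot {p} (p ℕ.^ m) i))) ∷ digits m (proj₂ (Fin.remQuot {p} (p ℕ.^ m) i))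

  length-digits : ∀ m i → length (digits m i) ≡ m
  length-digits zero    i = refl
  length-digits (suc m) i = cong suc (length-digits m _)

  digits-InPrimeField : ∀ m i → All InPrimeField (digits m i)
  digits-InPrimeField zero    i = []
  digits-InPrimeField (suc m) i = (toℕ (proj₁ (Fin.remQuot {p} (p ℕ.^ m) i)) , refl) ∷ digits-InPrimeField m _

  digits-injective : ∀ m {i j} → digits m i ≡ digits m j → i ≡ j
  digits-injective zero    {fzero} {fzero} _ = refl
  digits-injective (suc m) {i}     {j}     dᵢ≡dⱼ = begin
    i                                   ≡⟨ Fin.combine-remQuot {p} (p ℕ.^ m) i ⟨
    Fin.combine (quot i) (rem i)        ≡⟨ cong₂ Fin.combine quot-i≡quot-j rem-i≡rem-j ⟩
    Fin.combine (quot j) (rem j)        ≡⟨ Fin.combine-remQuot {p} (p ℕ.^ m) j ⟩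
    j                                   ∎
    where
    quot : Fin (p ℕ.^ suc m) → Fin p
    quot k = proj₁ (Fin.remQuot {p} (p ℕ.^ m) k)
    rem : Fin (p ℕ.^ suc m) → Fin (p ℕ.^ m)
    rem k = proj₂ (Fin.remQuot {p} (p ℕ.^ m) k)
    quot-i≡quot-j : quot i ≡ quot j
    quot-i≡quot-j = Fin.toℕ-injective
      (ι-injective (Fin.toℕ<n (quot i)) (Fin.toℕ<n (quot j)) (proj₁ (∷-injective dᵢ≡dⱼ)))
    rem-i≡rem-j : rem i ≡ rem j
    rem-i≡rem-j = digits-injective m (proj₂ (∷-injective dᵢ≡dⱼ))

  record Annihilator (x : 𝔽) : Set where
    field
      poly         : List (𝔽)
      poly∈𝔽ₚ      : All InPrimeField poly
      poly≢0       : NonZeroPoly poly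
      length≡1+d   : length poly ≡ suc d
      annihilates  : eval poly x ≡ 0#

  -- Two of the p^(d+1) digit strings of length d+1 give prime-field polynomials with the same
  -- value at x; their difference annihilates x.
  annihilator : ∀ x → Annihilator x
  annihilator x
    with Fin.pigeonhole (ℕ.^-monoʳ-< p (prime⇒>1 p-prime) (ℕ.n<1+n d)) (λ i → eval (digits (suc d) i) x)
  ... | i , j , i<j , Dᵢx≡Dⱼx = record
    { poly        = Dᵢ ⊖ Dⱼ
    ; poly∈𝔽ₚ     = coefficients Dᵢ Dⱼ (digits-InPrimeField (suc d) i) (digits-InPrimeField (suc d) j)
    ; poly≢0      = ⊖-nonZero Dᵢ Dⱼ |Dᵢ|≡|Dⱼ| (λ Dᵢ≡Dⱼ → ℕ.<⇒≢ i<j (cong toℕ (digits-injective (suc d) Dᵢ≡Dⱼ)))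
    ; length≡1+d  = trans (length-zipWith _-_ Dᵢ Dⱼ)
                      (trans (cong₂ ℕ._⊓_ (length-digits (suc d) i) (length-digits (suc d) j)) (ℕ.⊓-idem (suc d)))
    ; annihilates = trans (eval-⊖ Dᵢ Dⱼ x |Dᵢ|≡|Dⱼ|) (trans (cong (_- eval Dⱼ x) Dᵢx≡Dⱼx) (-‿inverseʳ _))
    }
    where
    Dᵢ Dⱼ : List 𝔽
    Dᵢ = digits (suc d) i
    Dⱼ = digits (suc d) j
    |Dᵢ|≡|Dⱼ| : length Dᵢ ≡ length Dⱼ
    |Dᵢ|≡|Dⱼ| = trans (length-digits (suc d) i) (sym (length-digits (suc d) j))
    coefficients : ∀ P Q → All InPrimeField P → All InPrimeField Q → All InPrimeField (P ⊖ Q)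
    coefficients []      _       _          _          = []
    coefficients (_ ∷ _) []      _          _          = []
    coefficients (_ ∷ P) (_ ∷ Q) (a∈ ∷ P∈) (b∈ ∷ Q∈) = InPrimeField-− a∈ b∈ ∷ coefficients P Q P∈ Q∈

  frob-orbit-injective : ∀ {x n} → HasOrder x n → ¬ p ∣ n → IsMultOrder p n d →
                         ∀ {i j} → i < j → j < d → frob i x ≢ frob j x
  frob-orbit-injective {x} {n} x∈n p∤n (_ , _ , d-minimal) {i} {j} i<j j<d σᵢx≡σⱼx =
    d-minimal (j ℕ.∸ i) (ℕ.m<n⇒0<n∸m i<j) (ℕ.≤-<-trans (ℕ.m∸n≤m j i) j<d)
      (coprime-divisor (Coprime.sym (coprime-^ (prime∤⇒coprime p-prime p∤n) i)) (subst (n ∣_) pʲ-pⁱ≡pⁱ[pʲ⁻ⁱ-1] n∣pʲ-pⁱ))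
    where
    n∣pʲ-pⁱ : n ∣ p ℕ.^ j ℕ.∸ p ℕ.^ i
    n∣pʲ-pⁱ = order∣∸ x∈n (ℕ.^-monoʳ-≤ p (ℕ.<⇒≤ i<j)) σᵢx≡σⱼx
    pʲ-pⁱ≡pⁱ[pʲ⁻ⁱ-1] : p ℕ.^ j ℕ.∸ p ℕ.^ i ≡ p ℕ.^ i ℕ.* (p ℕ.^ (j ℕ.∸ i) ℕ.∸ 1)
    pʲ-pⁱ≡pⁱ[pʲ⁻ⁱ-1] = sym (begin
      p ℕ.^ i ℕ.* (p ℕ.^ (j ℕ.∸ i) ℕ.∸ 1)                      ≡⟨ ℕ.*-distribˡ-∸ (p ℕ.^ i) (p ℕ.^ (j ℕ.∸ i)) 1 ⟩
      p ℕ.^ i ℕ.* p ℕ.^ (j ℕ.∸ i) ℕ.∸ p ℕ.^ i ℕ.* 1            ≡⟨ cong₂ ℕ._∸_ (ℕ.^-distribˡ-+-* p i (j ℕ.∸ i)) (sym (ℕ.*-identityʳ (p ℕ.^ i))) ⟨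
      p ℕ.^ (i ℕ.+ (j ℕ.∸ i)) ℕ.∸ p ℕ.^ i                      ≡⟨ cong (λ e → p ℕ.^ e ℕ.∸ p ℕ.^ i) (ℕ.m+[n∸m]≡n (ℕ.<⇒≤ i<j)) ⟩
      p ℕ.^ j ℕ.∸ p ℕ.^ i                                      ∎)

  module SemilinearMap (x x′ : 𝔽) (f : 𝔽 → 𝔽)
                       (f-+ : ∀ a b → f (a + b) ≡ f a + f b) (f-x : ∀ b → f (x * b) ≡ x′ * f b) where

    f-0# : f 0# ≡ 0#
    f-0# = x+x≈x⇒x≈0 (f 0#) (trans (sym (f-+ 0# 0#)) (cong f (+-identityˡ 0#)))

    f-ι : ∀ m b → f (ι m * b) ≡ ι m * f b
    f-ι zero    b = trans (cong f (zeroˡ b)) (trans f-0# (sym (zeroˡ (f b))))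
    f-ι (suc m) b = begin
      f ((1# + ι m) * b)      ≡⟨ cong f (trans (distribʳ b 1# (ι m)) (cong (_+ ι m * b) (*-identityˡ b))) ⟩
      f (b + ι m * b)         ≡⟨ f-+ b (ι m * b) ⟩
      f b + f (ι m * b)       ≡⟨ cong (f b +_) (f-ι m b) ⟩
      f b + ι m * f b         ≡⟨ cong (_+ ι m * f b) (*-identityˡ (f b)) ⟨
      1# * f b + ι m * f b    ≡⟨ distribʳ (f b) 1# (ι m) ⟨
      (1# + ι m) * f b        ∎

    f-eval : ∀ {P} → All InPrimeField P → ∀ b → f (eval P x * b) ≡ eval P x′ * f b
    f-eval [] b = trans (cong f (zeroˡ b)) (trans f-0# (sym (zeroˡ (f b))))
    f-eval {c ∷ P} ((m , refl) ∷ P∈𝔽ₚ) b = begin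
      f ((ι m + x * eval P x) * b)          ≡⟨ cong f (trans (distribʳ b (ι m) _) (cong (ι m * b +_) (*-assoc x _ b))) ⟩
      f (ι m * b + x * (eval P x * b))      ≡⟨ f-+ _ _ ⟩
      f (ι m * b) + f (x * (eval P x * b))  ≡⟨ cong₂ _+_ (f-ι m b) (f-x _) ⟩
      ι m * f b + x′ * f (eval P x * b)     ≡⟨ cong (λ z → ι m * f b + x′ * z) (f-eval P∈𝔽ₚ b) ⟩
      ι m * f b + x′ * (eval P x′ * f b)    ≡⟨ cong (ι m * f b +_) (*-assoc x′ _ (f b)) ⟨
      ι m * f b + (x′ * eval P x′) * f b    ≡⟨ distribʳ (f b) (ι m) _ ⟨
      (ι m + x′ * eval P x′) * f b          ∎

  semilinear⇒frob-orbit : ∀ {x n} → HasOrder x n → ¬ p ∣ n → IsMultOrder p n d →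
    ∀ x′ (f : 𝔽 → 𝔽) → (∀ a b → f (a + b) ≡ f a + f b) → (∀ a b → f a ≡ f b → a ≡ b) →
    (∀ b → f (x * b) ≡ x′ * f b) → ∃ λ (i : Fin d) → x′ ≡ frob (toℕ i) x
  semilinear⇒frob-orbit {x} x∈n p∤n d-order x′ f f-+ f-injective f-x
    with Fin.any? {n = d} (λ i → x′ ≟ frob (toℕ i) x)
  ... | yes x′∈orbit = x′∈orbit
  ... | no x′∉orbit = ⊥-elim (ℕ.<-irrefl refl (subst (suc d <_) length≡1+d (roots<length (suc d) P poly≢0 root root-injective P[root]≡0)))
    where
    open SemilinearMap x x′ f f-+ f-x
    open Annihilator (annihilator x) renaming (poly to P)

    root : Fin (suc d) → 𝔽
    root fzero    = x′
    root (fsuc i) = frob (toℕ i) x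

    root-injective : ∀ i j → root i ≡ root j → i ≡ j
    root-injective fzero    fzero    _  = refl
    root-injective fzero    (fsuc j) eq = ⊥-elim (x′∉orbit (j , eq))
    root-injective (fsuc i) fzero    eq = ⊥-elim (x′∉orbit (i , sym eq))
    root-injective (fsuc i) (fsuc j) eq with ℕ.<-cmp (toℕ i) (toℕ j)
    ... | tri< i<j _ _ = ⊥-elim (frob-orbit-injective x∈n p∤n d-order i<j (Fin.toℕ<n j) eq)
    ... | tri≈ _ i≡j _ = cong fsuc (Fin.toℕ-injective i≡j)
    ... | tri> _ _ j<i = ⊥-elim (frob-orbit-injective x∈n p∤n d-order j<i (Fin.toℕ<n i) (sym eq))

    f1≢0 : f 1# ≢ 0#
    f1≢0 f1≡0 = 1#≢0# (f-injective 1# 0# (trans f1≡0 (sym f-0#)))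

    Px′≡0 : eval P x′ ≡ 0#
    Px′≡0 with *≡0⇒ (eval P x′) (f 1#) (begin
      eval P x′ * f 1#   ≡⟨ f-eval poly∈𝔽ₚ 1# ⟨
      f (eval P x * 1#)  ≡⟨ cong (λ z → f (z * 1#)) annihilates ⟩
      f (0# * 1#)        ≡⟨ cong f (zeroˡ 1#) ⟩
      f 0#               ≡⟨ f-0# ⟩
      0#                 ∎)
    ... | inj₁ Px′≡0 = Px′≡0
    ... | inj₂ f1≡0  = ⊥-elim (f1≢0 f1≡0)

    P[root]≡0 : ∀ i → eval P (root i) ≡ 0#
    P[root]≡0 fzero    = Px′≡0
    P[root]≡0 (fsuc i) = trans (sym (frob-eval (toℕ i) poly∈𝔽ₚ x)) (trans (cong (frob (toℕ i)) annihilates) (frob-0# (toℕ i)))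

module GeneralisedPaley (p d : ℕ) (p-prime : Prime p) (K : FiniteField (p ℕ.^ d)) where
  open FiniteField K
  open FieldProperties K
  open PrimePowerField p d p-prime K
  open AffineGroup K
  open AffineGroupProperties K using (isInv)
  open ≡-Reasoning

  module MirrorByFrobenius {n x k} (x∈n : HasOrder x n) (n∣pᵏ+1 : n ∣ p ℕ.^ k ℕ.+ 1) where
    σ : 𝔽 → 𝔽
    σ = frob k

    x≢0 : x ≢ 0#
    x≢0 = order⇒≢0 x∈n

    a*σa≡1 : ∀ {a} → InS x a → a * σ a ≡ 1#
    a*σa≡1 (j , refl) = let divides c pᵏ+1≡cn = n∣pᵏ+1 in begin
      pow (pow x j) (suc (p ℕ.^ k))    ≡⟨ cong (pow (pow x j)) (trans (ℕ.+-comm 1 (p ℕ.^ k)) pᵏ+1≡cn) ⟩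
      pow (pow x j) (c ℕ.* n)          ≡⟨ pow-* x j (c ℕ.* n) ⟨
      pow x (j ℕ.* (c ℕ.* n))          ≡⟨ cong (pow x) (ℕ.*-assoc j c n) ⟨
      pow x (j ℕ.* c ℕ.* n)            ≡⟨ pow-*≡1 x n (j ℕ.* c) (proj₁ (proj₂ x∈n)) ⟩
      1#                               ∎

    x⁻¹ = pow x (n ℕ.∸ 1)

    σx⁻¹≡x : σ x⁻¹ ≡ x
    σx⁻¹≡x = *-cancelˡ x⁻¹ _ _ (pow≢0 (n ℕ.∸ 1) x≢0)
      (trans (a*σa≡1 (n ℕ.∸ 1 , refl))
        (sym (trans (*-comm x⁻¹ x) (x*xⁿ⁻¹≡1 x∈n))))

    module Semilinear (γ : 𝔽) (γ≢0 : γ ≢ 0#) where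
      φ : Aff → Aff
      φ (a , b) = (σ a , γ * σ b)

      φ-closed : ∀ g → InG x g → InG x (φ g)
      φ-closed (a , b) (j , a≡xʲ) = j ℕ.* p ℕ.^ k , trans (cong σ a≡xʲ) (sym (pow-* x j (p ℕ.^ k)))

      φ-hom : ∀ g h → InG x g → InG x h → φ (g ∘ₐ h) ≡ φ g ∘ₐ φ h
      φ-hom (a , b) (c , e) _ _ = cong₂ _,_ (frob-* k a c) (begin
        γ * σ (a * e + b)              ≡⟨ cong (γ *_) (trans (frob-+ k (a * e) b) (cong (_+ σ b) (frob-* k a e))) ⟩
        γ * (σ a * σ e + σ b)          ≡⟨ distribˡ γ _ _ ⟩
        γ * (σ a * σ e) + γ * σ b      ≡⟨ cong (_+ γ * σ b) (x*yz≡y*xz γ (σ a) (σ e)) ⟩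
        σ a * (γ * σ e) + γ * σ b      ∎)

      φ-injective : ∀ g h → InG x g → InG x h → φ g ≡ φ h → g ≡ h
      φ-injective (a , b) (c , e) _ _ φg≡φh = cong₂ _,_
        (frob-injective k (cong proj₁ φg≡φh))
        (frob-injective k (*-cancelˡ γ _ _ γ≢0 (cong proj₂ φg≡φh)))

      φ-surjective : ∀ h → InG x h → ∃ λ g → InG x g × φ g ≡ h
      φ-surjective (a , b) (j , a≡xʲ) =
        (pow x⁻¹ j , proj₁ σ-preimage) , ((n ℕ.∸ 1) ℕ.* j , sym (pow-* x (n ℕ.∸ 1) j)) ,
        cong₂ _,_ (trans (frob-pow k x⁻¹ j) (trans (cong (λ z → pow z j) σx⁻¹≡x) (sym a≡xʲ)))
                  (trans (cong (γ *_) (proj₂ σ-preimage)) (trans (x*yz≡y*xz γ b γ⁻¹)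
                     (trans (cong (b *_) (proj₂ (inverse γ γ≢0))) (*-identityʳ b))))
        where
        γ⁻¹ : 𝔽
        γ⁻¹ = proj₁ (inverse γ γ≢0)
        σ-preimage : ∃ λ c → σ c ≡ b * γ⁻¹
        σ-preimage = frob-surjective k (b * γ⁻¹)

      φx-inverse : IsInv (x , 0#) (φ (x , 0#))
      φx-inverse = isInv (a*σa≡1 (1 , sym (pow-identityʳ x)))
        (trans (+-identityʳ _) (trans (cong (x *_) γσ0≡0) (zeroʳ x)))
        (trans (cong₂ _+_ (zeroʳ (σ x)) γσ0≡0) (+-identityˡ 0#))
        where
        γσ0≡0 : γ * σ 0# ≡ 0#
        γσ0≡0 = trans (cong (γ *_) (frob-0# k)) (zeroʳ γ)

    mirror : ∀ {y} → IsGP n x y → Real x y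
    mirror {ya , yb} (_ , ya∈S , y∉S) =
      φ , φ-closed , φ-hom , φ-injective , φ-surjective , φx-inverse ,
      isInv (a*σa≡1 ya∈S) (trans (cong (_+ yb) ya[γσyb]≡-yb) (-‿inverseˡ yb))
                          (trans (cong (σ ya * yb +_) γσyb≡-σya*yb) (-‿inverseʳ _))
      where
      yb≢0 : yb ≢ 0#
      yb≢0 yb≡0 = y∉S (ya∈S , yb≡0)
      w : 𝔽
      w = ya * σ yb
      w≢0 : w ≢ 0#
      w≢0 = *≢0 (λ ya≡0 → 1#≢0# (trans (sym (a*σa≡1 ya∈S)) (trans (cong (_* σ ya) ya≡0) (zeroˡ _))))
                (pow≢0 (p ℕ.^ k) yb≢0)
      w⁻¹ : 𝔽
      w⁻¹ = proj₁ (inverse w w≢0)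
      w⁻¹*w≡1 : w⁻¹ * w ≡ 1#
      w⁻¹*w≡1 = trans (*-comm w⁻¹ w) (proj₂ (inverse w w≢0))
      γ : 𝔽
      γ = - (yb * w⁻¹)  -- forced by requiring y ∘ φ y to have translation part 0
      ya[γσyb]≡-yb : ya * (γ * σ yb) ≡ - yb
      ya[γσyb]≡-yb = begin
        ya * (γ * σ yb)        ≡⟨ x*yz≡y*xz ya γ (σ yb) ⟩
        γ * w                  ≡⟨ -‿distribˡ-* (yb * w⁻¹) w ⟨
        - ((yb * w⁻¹) * w)     ≡⟨ cong -_ (trans (*-assoc yb w⁻¹ w) (trans (cong (yb *_) w⁻¹*w≡1) (*-identityʳ yb))) ⟩
        - yb                   ∎
      γ≢0 : γ ≢ 0#
      γ≢0 γ≡0 = yb≢0 (begin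
        yb                     ≡⟨ -‿involutive yb ⟨
        - - yb                 ≡⟨ cong -_ ya[γσyb]≡-yb ⟨
        - (ya * (γ * σ yb))    ≡⟨ cong (λ z → - (ya * (z * σ yb))) γ≡0 ⟩
        - (ya * (0# * σ yb))   ≡⟨ cong -_ (trans (cong (ya *_) (zeroˡ _)) (zeroʳ ya)) ⟩
        - 0#                   ≡⟨ -0#≈0# ⟩
        0#                     ∎)
      open Semilinear γ γ≢0
      w*σya≡σyb : w * σ ya ≡ σ yb
      w*σya≡σyb = begin
        (ya * σ yb) * σ ya     ≡⟨ *-assoc ya (σ yb) (σ ya) ⟩
        ya * (σ yb * σ ya)     ≡⟨ x*yz≡y*xz ya (σ yb) (σ ya) ⟩
        σ yb * (ya * σ ya)     ≡⟨ cong (σ yb *_) (a*σa≡1 ya∈S) ⟩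
        σ yb * 1#              ≡⟨ *-identityʳ _ ⟩
        σ yb                   ∎
      γσyb≡-σya*yb : γ * σ yb ≡ - (σ ya * yb)
      γσyb≡-σya*yb = begin
        - (yb * w⁻¹) * σ yb          ≡⟨ -‿distribˡ-* (yb * w⁻¹) (σ yb) ⟨
        - ((yb * w⁻¹) * σ yb)        ≡⟨ cong (λ z → - ((yb * w⁻¹) * z)) w*σya≡σyb ⟨
        - ((yb * w⁻¹) * (w * σ ya))  ≡⟨ cong -_ (*-assoc yb w⁻¹ (w * σ ya)) ⟩
        - (yb * (w⁻¹ * (w * σ ya)))  ≡⟨ cong (λ z → - (yb * z)) (trans (sym (*-assoc w⁻¹ w (σ ya))) (trans (cong (_* σ ya) w⁻¹*w≡1) (*-identityˡ _))) ⟩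
        - (yb * σ ya)                ≡⟨ cong -_ (*-comm yb (σ ya)) ⟩
        - (σ ya * yb)                ∎

  frob-inverse⇒∣ : ∀ {x n x′} i → HasOrder x n → x * x′ ≡ 1# → x′ ≡ frob i x → n ∣ p ℕ.^ i ℕ.+ 1
  frob-inverse⇒∣ {x} {x′ = x′} i x∈n xx′≡1 x′≡σⁱx = order∣ x∈n _ (begin
    pow x (p ℕ.^ i ℕ.+ 1)   ≡⟨ pow-+ x (p ℕ.^ i) 1 ⟩
    frob i x * pow x 1      ≡⟨ cong₂ _*_ x′≡σⁱx (sym (pow-identityʳ x)) ⟨
    x′ * x                  ≡⟨ *-comm x′ x ⟩
    x * x′                  ≡⟨ xx′≡1 ⟩
    1#                      ∎)

  real⇒inverse∈orbit : ∀ {n x y} → IsMultOrder p n d → ¬ p ∣ n → HasOrder x n → 1 < n → Real x y →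
                       ∃ λ (i : Fin d) → pow x (n ℕ.∸ 1) ≡ frob (toℕ i) x
  real⇒inverse∈orbit d-order p∤n x∈n 1<n real =
    semilinear⇒frob-orbit x∈n p∤n d-order _ translation-part translation-part-+ translation-part-injective translation-part-x
    where open AffineGroupProperties.TranslationPart K x∈n (order>1⇒≢1 x∈n 1<n) real

  real⇒∣ : ∀ {n x y} → IsMultOrder p n d → ¬ p ∣ n → IsGP n x y → Real x y → ∃ λ (i : Fin d) → n ∣ p ℕ.^ toℕ i ℕ.+ 1
  real⇒∣ {n} d-order p∤n (x∈n , _) real with n ℕ.≟ 1
  ... | yes refl = Fin.fromℕ< (proj₁ d-order) , 1∣ _
  ... | no n≢1 with real⇒inverse∈orbit d-order p∤n x∈n (ℕ.≤∧≢⇒< (proj₁ x∈n) (n≢1 ∘ sym)) real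
  ...   | i , x⁻¹≡σⁱx = i , frob-inverse⇒∣ (toℕ i) x∈n (x*xⁿ⁻¹≡1 x∈n) x⁻¹≡σⁱx

  ∣⇒allReal : ∀ {n} → (∃ λ k → n ∣ p ℕ.^ k ℕ.+ 1) → AllReal n
  ∣⇒allReal (k , n∣pᵏ+1) x y gp = MirrorByFrobenius.mirror {k = k} (proj₁ gp) n∣pᵏ+1 gp

  allReal⇒∣ : ∀ {n} → IsMultOrder p n d → ¬ p ∣ n → AllReal n → ∃ λ k → n ∣ p ℕ.^ k ℕ.+ 1
  allReal⇒∣ {n} d-order p∤n allReal with element-of-order (proj₁ (proj₂ d-order))
  ... | x , x∈n with real⇒∣ d-order p∤n gp (allReal x (1# , 1#) gp)
    where
    gp : IsGP n x (1# , 1#)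
    gp = x∈n , (0 , refl) , λ (_ , 1≡0) → 1#≢0# 1≡0
  ...   | i , n∣pⁱ+1 = toℕ i , n∣pⁱ+1

  allReal⊎allChiral : ∀ {n} → IsMultOrder p n d → ¬ p ∣ n → AllReal n ⊎ AllChiral n
  allReal⊎allChiral {n} d-order p∤n with Fin.any? {n = d} (λ i → n ∣? p ℕ.^ toℕ i ℕ.+ 1)
  ... | yes (i , n∣pⁱ+1) = inj₁ (∣⇒allReal (toℕ i , n∣pⁱ+1))
  ... | no none          = inj₂ (λ x y gp real → none (real⇒∣ d-order p∤n gp real))

open import Data.Nat using (_+_; _^_)
open import Function.Bundles using (_⇔_; mk⇔)

proposition4p3 : (n p : ℕ) → 1 ≤ n → Prime p → ¬ (p ∣ n) →
    (d : ℕ) → IsMultOrder p n d → (K : FiniteField (p ^ d)) →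
    (AffineGroup.AllReal K n ⊎ AffineGroup.AllChiral K n)
    × (AffineGroup.AllReal K n ⇔ (∃ λ k → n ∣ (p ^ k + 1)))
proposition4p3 n p _ p-prime p∤n d d-order K =  -- 1 ≤ n is implied by IsMultOrder p n d
  allReal⊎allChiral d-order p∤n , mk⇔ (allReal⇒∣ d-order p∤n) ∣⇒allReal
  where open GeneralisedPaley p d p-prime K
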